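{- Let $n\ge5$ be an integer, let $a$ be a positive integer, and let $\mathbf{a}^{(n-1)}=(a,\dots,a)$ be the constant sequence of length $n-1$. Let $h_i^*(\mathbf{a}^{(n-1)})$ be the coefficient of $z^i$ in the $h^*$-polynomial of $\mathcal{P}_{n-1}^{\mathbf{a}^{(n-1)}}$, and define the polynomial $$\mathcal{R}(t)=\sum_{i=0}^{n-1}h_i^*(\mathbf{a}^{(n-1)})\binom{t+n-i-1}{n},$$ where $\binom{t+c}{n}=\frac{(t+c)(t+c-1)\cdots(t+c-n+1)}{n!}$ is viewed as a polynomial in $t$. Then, as $a\to\infty$, $$[t^{n-4}]\mathcal{R}(t)\sim-\frac{a^{n-1}}{720\,(n-4)!}.$$
   Context: For a sequence of positive integers $\mathbf{s}=(s_1,\dots,s_m)$, $\mathcal{P}_m^{\mathbf{s}}=\{\mathbf{x}\in\mathbb{R}^m : 0\le x_1/s_1\le\dots\le x_m/s_m\le1\}$. For a $d$-dimensional lattice polytope $P$ with Ehrhart polynomial $\mathcal{L}_P(t)=|tP\cap\mathbb{Z}^m|$, its $h^*$-polynomial is the polynomial $h^*_P(z)$ of degree at most $d$ with $\sum_{t\ge0}\mathcal{L}_P(t)z^t=h^*_P(z)/(1-z)^{d+1}$. $[t^\ell]Q(t)$ denotes the coefficient of $t^\ell$ in $Q$. -}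

module Defs where

open import Data.Bool using (Bool; true; false; _∧_)
open import Data.Nat as ℕ using (ℕ; zero; suc; _∸_; _!; NonZero)
open import Data.Nat.Properties using (_!≢0; m*n≢0)
open import Data.Nat.Combinatorics using (_C_)
open import Data.Integer as ℤ using (ℤ; +_)
open import Data.Rational as ℚ using (ℚ; 0ℚ; 1ℚ; _≤ᵇ_)
open import Data.List using (List; []; _∷_; map; concatMap; filterᵇ; length; replicate; upTo; foldr)

-- x / s as a rational number (s is assumed positive; the s = 0 branch
-- is never used for the sequences in the theorem).
frac : ℕ → ℕ → ℚ
frac x zero    = 0ℚ
frac x (suc k) = (+ x) ℚ./ suc k

chain : ℚ → List ℚ → ℚ → Bool
chain p []       t = p ≤ᵇ t
chain p (q ∷ qs) t = (p ≤ᵇ q) ∧ chain q qs t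

fracs : List ℕ → List ℕ → List ℚ
fracs (x ∷ xs) (s ∷ ss) = frac x s ∷ fracs xs ss
fracs _        _        = []

-- x ∈ t·P_m^s   iff   0 ≤ x₁/s₁ ≤ … ≤ x_m/s_m ≤ t
inDilate : ℕ → List ℕ → List ℕ → Bool
inDilate t s x = chain 0ℚ (fracs x s) ((+ t) ℚ./ 1)

box : List ℕ → List (List ℕ)
box []       = [] ∷ []
box (b ∷ bs) = concatMap (λ x → map (x ∷_) (box bs)) (upTo (suc b))

-- Ehrhart function L_P(t) = |t P ∩ ℤ^m| for P = P_m^s.
-- Every integer point of tP satisfies 0 ≤ x_i ≤ t s_i, so it suffices
-- to enumerate that box.
ehrhart : List ℕ → ℕ → ℕ
ehrhart s t = length (filterᵇ (inDilate t s) (box (map (t ℕ.*_) s)))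

-- h*-coefficients.  P_m^s is full-dimensional (d = m), so
-- h*(z) = (1 - z)^{m+1} Σ_t L(t) z^t, whose z^i coefficient is
-- Σ_{j=0}^{i} (-1)^j C(m+1, j) L(i - j).

sign : ℕ → ℤ
sign zero    = + 1
sign (suc j) = ℤ.- sign j

hstarAux : List ℕ → ℕ → ℕ → ℤ
hstarAux s i zero    = sign 0 ℤ.* (+ ((suc (length s)) C 0)) ℤ.* (+ ehrhart s i)
hstarAux s i (suc k) = hstarAux s i k ℤ.+
  sign (suc k) ℤ.* (+ ((suc (length s)) C (suc k))) ℤ.* (+ ehrhart s (i ∸ suc k))

hstar : List ℕ → ℕ → ℤ
hstar s i = hstarAux s i i

-- Polynomials in t over ℚ as coefficient lists (lowest degree first).

Poly : Set
Poly = List ℚ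

_+ₚ_ : Poly → Poly → Poly
[]       +ₚ q        = q
(a ∷ p)  +ₚ []       = a ∷ p
(a ∷ p)  +ₚ (b ∷ q)  = (a ℚ.+ b) ∷ (p +ₚ q)

scaleₚ : ℚ → Poly → Poly
scaleₚ c = map (c ℚ.*_)

_*ₚ_ : Poly → Poly → Poly
[]      *ₚ q = []
(a ∷ p) *ₚ q = scaleₚ a q +ₚ (0ℚ ∷ (p *ₚ q))

coeff : ℕ → Poly → ℚ
coeff _       []      = 0ℚ
coeff zero    (a ∷ p) = a
coeff (suc l) (a ∷ p) = coeff l p

ℤtoℚ : ℤ → ℚ
ℤtoℚ z = z ℚ./ 1

fallingProd : ℕ → ℕ → Poly
fallingProd c zero    = 1ℚ ∷ []
fallingProd c (suc k) = fallingProd c k *ₚ (ℤtoℚ ((+ c) ℤ.- (+ k)) ∷ 1ℚ ∷ [])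

binomPoly : ℕ → ℕ → Poly
binomPoly c n = scaleₚ (ℚ._/_ (+ 1) (n !) ⦃ n !≢0 ⦄) (fallingProd c n)

constSeq : ℕ → ℕ → List ℕ
constSeq m a = replicate m a

RAux : ℕ → ℕ → ℕ → Poly
RAux n a zero    = []
RAux n a (suc i) = RAux n a i +ₚ
  scaleₚ (ℤtoℚ (hstar (constSeq (n ∸ 1) a) i)) (binomPoly (n ∸ i ∸ 1) n)

R : ℕ → ℕ → Poly
R n a = RAux n a n

mainTerm : ℕ → ℕ → ℚ
mainTerm n a = ℚ.- (ℚ._/_ (+ (a ℕ.^ (n ∸ 1))) (720 ℕ.* (n ∸ 4) !)
  ⦃ m*n≢0 720 ((n ∸ 4) !) ⦃ _ ⦄ ⦃ (n ∸ 4) !≢0 ⦄ ⦄)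

-- The Ehrhart function of P = P_m^(a,…,a) counts chains 0 ≤ x₁ ≤ ⋯ ≤ x_m ≤ at, so
-- L(t) = C(at + m, m), and the h*-vector inverts L(t) = Σᵢ h*ᵢ C(t − i + m, m). With n = m + 1,
-- Pascal's rule turns this into R(t + 1) − R(t) = L(t) for t = 0, …, m; both sides have degree
-- at most m, so it is an identity of polynomials, and comparing coefficients determines those of R
-- from the top down. The part aᵐ tᵐ/m! of L(t) has the discrete antiderivative
-- aᵐ Σᵢ B_{n−i} tⁱ/(i! (n − i)!) (Faulhaber), whose coefficient of t^(n−4) is
-- aᵐ B₄/(4! (n − 4)!) = −aᵐ/(720 (n − 4)!); the rest of L(t) has coefficients O(a^(m−1)), and
-- back-substitution keeps the coefficients of R minus this antiderivative O(a^(m−1)).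

module Submission where

open import Algebra.Structures using (IsCommutativeSemiring; IsCommutativeRing)
open import Data.Bool using (Bool; true; false; _∧_; T; if_then_else_)
open import Data.Empty using (⊥-elim)
open import Data.Integer as ℤ using (ℤ; +_; -[1+_])
import Data.Integer.Properties as ℤₚ
open import Data.Integer.Tactic.RingSolver as ℤ-Solver using ()
open import Data.List using (List; []; _∷_; length; map; replicate; take; filterᵇ; concatMap; applyUpTo; _++_)
open import Data.List.Properties using (length-++; filter-++; map-replicate; length-replicate; length-applyUpTo)
open import Data.Maybe.Base using (Maybe; just; nothing)
open import Data.Nat as ℕ using (ℕ; zero; suc; z≤n; s≤s; _≤_; _∸_; _^_; _!; _≤ᵇ_; NonZero)
open import Data.Nat.Combinatorics
  using (_C_; nCn≡1; nC1≡n; k>n⇒nCk≡0; nCk≡nC[n∸k]; nCk+nC[k+1]≡[n+1]C[k+1]; nCk≡n!/k![n-k]!; k![n∸k]!∣n!)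
open import Data.Nat.DivMod using (m*[n/m]≡n)
open import Data.Nat.Properties using (_!≢0; _!*_!≢0)
import Data.Nat.Properties as ℕₚ
open import Data.Product using (_×_; _,_; proj₁; proj₂; ∃-syntax)
open import Data.Rational as ℚ using (ℚ; mkℚ; 0ℚ; 1ℚ; _+_; _*_; -_; _-_; _/_; ∣_∣; _<_)
import Data.Rational.Properties as ℚₚ
import Data.Rational.Unnormalised as ℚᵘ
import Data.Rational.Unnormalised.Properties as ℚᵘₚ
open import Data.Sum using (_⊎_; inj₁; inj₂)
open import Data.Unit using (tt)
open import Function using (_∘_; id)
open import Level using (0ℓ)
open import Relation.Binary.Definitions using (Tri; tri<; tri≈; tri>)
open import Relation.Binary.PropositionalEquality
open import Relation.Nullary using (yes; no)
open import Tactic.RingSolver using (solve-∀)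
import Tactic.RingSolver.Core.AlmostCommutativeRing as ACR

open import Defs

ℚ-ring : ACR.AlmostCommutativeRing 0ℓ 0ℓ
ℚ-ring = ACR.fromCommutativeRing ℚₚ.+-*-commutativeRing isZero
  where
  isZero : ∀ x → Maybe (0ℚ ≡ x)
  isZero x with 0ℚ ℚₚ.≟ x
  ... | yes 0≡x = just 0≡x
  ... | no _    = nothing

toℚᵘ-/ : ∀ z d → ℚ.toℚᵘ (z / suc d) ℚᵘ.≃ ℚᵘ.mkℚᵘ z d
toℚᵘ-/ z d = ℚₚ.toℚᵘ-fromℚᵘ (ℚᵘ.mkℚᵘ z d)

ℤtoℚ-homo-+ : ∀ x y → ℤtoℚ (x ℤ.+ y) ≡ ℤtoℚ x + ℤtoℚ y
ℤtoℚ-homo-+ x y = ℚₚ.toℚᵘ-injective (begin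
  ℚ.toℚᵘ (ℤtoℚ (x ℤ.+ y))              ≈⟨ toℚᵘ-/ (x ℤ.+ y) 0 ⟩
  ℚᵘ.mkℚᵘ (x ℤ.+ y) 0                  ≈⟨ ℚᵘ.*≡* (cross x y) ⟩
  ℚᵘ.mkℚᵘ x 0 ℚᵘ.+ ℚᵘ.mkℚᵘ y 0          ≈⟨ ℚᵘₚ.+-cong (toℚᵘ-/ x 0) (toℚᵘ-/ y 0) ⟨
  ℚ.toℚᵘ (ℤtoℚ x) ℚᵘ.+ ℚ.toℚᵘ (ℤtoℚ y)  ≈⟨ ℚₚ.toℚᵘ-homo-+ (ℤtoℚ x) (ℤtoℚ y) ⟨
  ℚ.toℚᵘ (ℤtoℚ x + ℤtoℚ y)              ∎)
  where
  open ℚᵘₚ.≃-Reasoning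
  cross : ∀ x y → (x ℤ.+ y) ℤ.* (+ 1 ℤ.* + 1) ≡ (x ℤ.* + 1 ℤ.+ y ℤ.* + 1) ℤ.* + 1
  cross = ℤ-Solver.solve-∀

ℤtoℚ-homo-* : ∀ x y → ℤtoℚ (x ℤ.* y) ≡ ℤtoℚ x * ℤtoℚ y
ℤtoℚ-homo-* x y = ℚₚ.toℚᵘ-injective (begin
  ℚ.toℚᵘ (ℤtoℚ (x ℤ.* y))              ≈⟨ toℚᵘ-/ (x ℤ.* y) 0 ⟩
  ℚᵘ.mkℚᵘ (x ℤ.* y) 0                  ≈⟨ ℚᵘ.*≡* (cross x y) ⟩
  ℚᵘ.mkℚᵘ x 0 ℚᵘ.* ℚᵘ.mkℚᵘ y 0          ≈⟨ ℚᵘₚ.*-cong (toℚᵘ-/ x 0) (toℚᵘ-/ y 0) ⟨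
  ℚ.toℚᵘ (ℤtoℚ x) ℚᵘ.* ℚ.toℚᵘ (ℤtoℚ y)  ≈⟨ ℚₚ.toℚᵘ-homo-* (ℤtoℚ x) (ℤtoℚ y) ⟨
  ℚ.toℚᵘ (ℤtoℚ x * ℤtoℚ y)              ∎)
  where
  open ℚᵘₚ.≃-Reasoning
  cross : ∀ x y → (x ℤ.* y) ℤ.* (+ 1 ℤ.* + 1) ≡ (x ℤ.* y) ℤ.* + 1
  cross = ℤ-Solver.solve-∀

ℕtoℚ : ℕ → ℚ
ℕtoℚ n = ℤtoℚ (+ n)

ℕtoℚ-homo-+ : ∀ m n → ℕtoℚ (m ℕ.+ n) ≡ ℕtoℚ m + ℕtoℚ n
ℕtoℚ-homo-+ m n = ℤtoℚ-homo-+ (+ m) (+ n)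

ℕtoℚ-homo-* : ∀ m n → ℕtoℚ (m ℕ.* n) ≡ ℕtoℚ m * ℕtoℚ n
ℕtoℚ-homo-* m n = trans (cong ℤtoℚ (ℤₚ.pos-* m n)) (ℤtoℚ-homo-* (+ m) (+ n))

ℕtoℚ-mono-≤ : ∀ {m n} → m ≤ n → ℕtoℚ m ℚ.≤ ℕtoℚ n
ℕtoℚ-mono-≤ {m} {n} m≤n = ℚₚ.toℚᵘ-cancel-≤ (ℚᵘₚ.≤-respʳ-≃ (ℚᵘₚ.≃-sym (toℚᵘ-/ (+ n) 0))
  (ℚᵘₚ.≤-respˡ-≃ (ℚᵘₚ.≃-sym (toℚᵘ-/ (+ m) 0))
    (ℚᵘ.*≤* (ℤₚ.*-monoʳ-≤-nonNeg (+ 1) (ℤ.+≤+ m≤n)))))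

ℕtoℚ-mono-< : ∀ {m n} → m ℕ.< n → ℕtoℚ m < ℕtoℚ n
ℕtoℚ-mono-< {m} {n} m<n = ℚₚ.toℚᵘ-cancel-< (ℚᵘₚ.<-respʳ-≃ (ℚᵘₚ.≃-sym (toℚᵘ-/ (+ n) 0))
  (ℚᵘₚ.<-respˡ-≃ (ℚᵘₚ.≃-sym (toℚᵘ-/ (+ m) 0))
    (ℚᵘ.*<* (ℤₚ.*-monoʳ-<-pos (+ 1) (ℤ.+<+ m<n)))))

ℕtoℚ-*-inverse : ∀ d .{{_ : NonZero d}} → ℕtoℚ d * ((+ 1) / d) ≡ 1ℚ
ℕtoℚ-*-inverse (suc d) = ℚₚ.toℚᵘ-injective (begin
  ℚ.toℚᵘ (ℕtoℚ (suc d) * ((+ 1) / suc d))                 ≈⟨ ℚₚ.toℚᵘ-homo-* (ℕtoℚ (suc d)) ((+ 1) / suc d) ⟩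
  ℚ.toℚᵘ (ℕtoℚ (suc d)) ℚᵘ.* ℚ.toℚᵘ ((+ 1) / suc d)      ≈⟨ ℚᵘₚ.*-cong (toℚᵘ-/ (+ suc d) 0) (toℚᵘ-/ (+ 1) d) ⟩
  ℚᵘ.mkℚᵘ (+ suc d) 0 ℚᵘ.* ℚᵘ.mkℚᵘ (+ 1) d               ≈⟨ ℚᵘ.*≡* (cross (+ suc d)) ⟩
  ℚᵘ.1ℚᵘ                                                 ∎)
  where
  open ℚᵘₚ.≃-Reasoning
  cross : ∀ D → (D ℤ.* + 1) ℤ.* + 1 ≡ + 1 ℤ.* (+ 1 ℤ.* D)
  cross = ℤ-Solver.solve-∀

/-as-* : ∀ z d .{{_ : NonZero d}} → z / d ≡ ℤtoℚ z * ((+ 1) / d)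
/-as-* z (suc d) = ℚₚ.toℚᵘ-injective (begin
  ℚ.toℚᵘ (z / suc d)                            ≈⟨ toℚᵘ-/ z d ⟩
  ℚᵘ.mkℚᵘ z d                                   ≈⟨ ℚᵘ.*≡* (cross z (+ suc d)) ⟩
  ℚᵘ.mkℚᵘ z 0 ℚᵘ.* ℚᵘ.mkℚᵘ (+ 1) d              ≈⟨ ℚᵘₚ.*-cong (toℚᵘ-/ z 0) (toℚᵘ-/ (+ 1) d) ⟨
  ℚ.toℚᵘ (ℤtoℚ z) ℚᵘ.* ℚ.toℚᵘ ((+ 1) / suc d)   ≈⟨ ℚₚ.toℚᵘ-homo-* (ℤtoℚ z) ((+ 1) / suc d) ⟨
  ℚ.toℚᵘ (ℤtoℚ z * ((+ 1) / suc d))             ∎)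
  where
  open ℚᵘₚ.≃-Reasoning
  cross : ∀ z D → z ℤ.* (+ 1 ℤ.* D) ≡ (z ℤ.* + 1) ℤ.* D
  cross = ℤ-Solver.solve-∀

ℕtoℚ-*-cancelˡ : ∀ d .{{_ : NonZero d}} {p q} → ℕtoℚ d * p ≡ ℕtoℚ d * q → p ≡ q
ℕtoℚ-*-cancelˡ d {p} {q} dp≡dq = trans (undo p) (trans (cong (d⁻¹ *_) dp≡dq) (sym (undo q)))
  where
  d⁻¹ = (+ 1) / d
  undo : ∀ x → x ≡ d⁻¹ * (ℕtoℚ d * x)
  undo x = sym (begin
    d⁻¹ * (ℕtoℚ d * x)   ≡⟨ ℚₚ.*-assoc d⁻¹ (ℕtoℚ d) x ⟨
    (d⁻¹ * ℕtoℚ d) * x   ≡⟨ cong (_* x) (trans (ℚₚ.*-comm d⁻¹ (ℕtoℚ d)) (ℕtoℚ-*-inverse d)) ⟩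
    1ℚ * x               ≡⟨ ℚₚ.*-identityˡ x ⟩
    x                    ∎)
    where open ≡-Reasoning

*-inverse-unique : ∀ {a u v} → a * u ≡ 1ℚ → a * v ≡ 1ℚ → u ≡ v
*-inverse-unique {a} {u} {v} au≡1 av≡1 = begin
  u              ≡⟨ ℚₚ.*-identityʳ u ⟨
  u * 1ℚ         ≡⟨ cong (u *_) av≡1 ⟨
  u * (a * v)    ≡⟨ regroup u a v ⟩
  (a * u) * v    ≡⟨ cong (_* v) au≡1 ⟩
  1ℚ * v         ≡⟨ ℚₚ.*-identityˡ v ⟩
  v              ∎
  where
  open ≡-Reasoning
  regroup : ∀ u a v → u * (a * v) ≡ (a * u) * v
  regroup = solve-∀ ℚ-ring

invℕ-* : ∀ x y .{{_ : NonZero x}} .{{_ : NonZero y}} →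
         ((+ 1) / (x ℕ.* y)) {{ℕₚ.m*n≢0 x y}} ≡ (((+ 1) / x) * ((+ 1) / y))
invℕ-* x y = *-inverse-unique {ℕtoℚ (x ℕ.* y)} (ℕtoℚ-*-inverse (x ℕ.* y) {{ℕₚ.m*n≢0 x y}}) (begin
  ℕtoℚ (x ℕ.* y) * ((((+ 1) / x) * ((+ 1) / y)))
    ≡⟨ cong (_* ((((+ 1) / x) * ((+ 1) / y)))) (ℕtoℚ-homo-* x y) ⟩
  ℕtoℚ x * ℕtoℚ y * ((((+ 1) / x) * ((+ 1) / y)))
    ≡⟨ regroup (ℕtoℚ x) (ℕtoℚ y) ((+ 1) / x) ((+ 1) / y) ⟩
  (ℕtoℚ x * ((+ 1) / x)) * (ℕtoℚ y * ((+ 1) / y))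
    ≡⟨ cong₂ _*_ (ℕtoℚ-*-inverse x) (ℕtoℚ-*-inverse y) ⟩
  1ℚ * 1ℚ
    ≡⟨⟩
  1ℚ ∎)
  where
  open ≡-Reasoning
  regroup : ∀ x y u v → x * y * (u * v) ≡ (x * u) * (y * v)
  regroup = solve-∀ ℚ-ring

archimedean : ∀ q → ∃[ N ] q < ℕtoℚ N
archimedean (mkℚ (+ n) d-1 _) = suc n , ℚₚ.toℚᵘ-cancel-<
  (ℚᵘₚ.<-respʳ-≃ (ℚᵘₚ.≃-sym (toℚᵘ-/ (+ suc n) 0)) (ℚᵘ.*<* (subst₂ ℤ._<_
    (ℤₚ.pos-* n 1) (ℤₚ.pos-* (suc n) (suc d-1))
    (ℤ.+<+ (ℕₚ.<-≤-trans (ℕₚ.≤-reflexive (cong suc (ℕₚ.*-identityʳ n))) (ℕₚ.m≤m*n (suc n) (suc d-1)))))))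
archimedean (mkℚ -[1+ n ] _ _) = 0 , ℚₚ.toℚᵘ-cancel-<
  (ℚᵘₚ.<-respʳ-≃ (ℚᵘₚ.≃-sym (toℚᵘ-/ (+ 0) 0)) (ℚᵘ.*<* ℤ.-<+))

module FiniteSum {A : Set} {_+_ _*_ : A → A → A} {0# 1# : A}
                 (isCommutativeSemiring : IsCommutativeSemiring _≡_ _+_ _*_ 0# 1#) where

  open IsCommutativeSemiring isCommutativeSemiring
    using (+-assoc; +-comm; +-identityˡ; +-identityʳ; zeroʳ; distribˡ)

  ∑< : ℕ → (ℕ → A) → A
  ∑< zero    f = 0#
  ∑< (suc n) f = ∑< n f + f n

  ∑<-cong : ∀ n {f g} → (∀ {i} → i ℕ.< n → f i ≡ g i) → ∑< n f ≡ ∑< n g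
  ∑<-cong zero    f≗g = refl
  ∑<-cong (suc n) f≗g = cong₂ _+_ (∑<-cong n (f≗g ∘ ℕₚ.m<n⇒m<1+n)) (f≗g ℕₚ.≤-refl)

  ∑<-zero : ∀ n {f} → (∀ {i} → i ℕ.< n → f i ≡ 0#) → ∑< n f ≡ 0#
  ∑<-zero zero    f≗0 = refl
  ∑<-zero (suc n) f≗0 = trans (cong₂ _+_ (∑<-zero n (f≗0 ∘ ℕₚ.m<n⇒m<1+n)) (f≗0 ℕₚ.≤-refl)) (+-identityˡ 0#)

  ∑<-+ : ∀ n f g → ∑< n (λ i → f i + g i) ≡ ∑< n f + ∑< n g
  ∑<-+ zero    f g = sym (+-identityˡ 0#)
  ∑<-+ (suc n) f g = begin
    ∑< n (λ i → f i + g i) + (f n + g n)   ≡⟨ cong (_+ (f n + g n)) (∑<-+ n f g) ⟩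
    (∑< n f + ∑< n g) + (f n + g n)        ≡⟨ +-assoc (∑< n f) (∑< n g) (f n + g n) ⟩
    ∑< n f + (∑< n g + (f n + g n))        ≡⟨ cong (_+_ (∑< n f)) (sym (+-assoc (∑< n g) (f n) (g n))) ⟩
    ∑< n f + ((∑< n g + f n) + g n)        ≡⟨ cong (λ x → ∑< n f + (x + g n)) (+-comm (∑< n g) (f n)) ⟩
    ∑< n f + ((f n + ∑< n g) + g n)        ≡⟨ cong (_+_ (∑< n f)) (+-assoc (f n) (∑< n g) (g n)) ⟩
    ∑< n f + (f n + (∑< n g + g n))        ≡⟨ sym (+-assoc (∑< n f) (f n) (∑< n g + g n)) ⟩
    (∑< n f + f n) + (∑< n g + g n)        ∎
    where open ≡-Reasoning

  ∑<-*ˡ : ∀ n c f → ∑< n (λ i → c * f i) ≡ c * ∑< n f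
  ∑<-*ˡ zero    c f = sym (zeroʳ c)
  ∑<-*ˡ (suc n) c f = trans (cong (_+ (c * f n)) (∑<-*ˡ n c f)) (sym (distribˡ c (∑< n f) (f n)))

  ∑<-suc : ∀ n f → ∑< (suc n) f ≡ f 0 + ∑< n (f ∘ suc)
  ∑<-suc zero    f = trans (+-identityˡ (f 0)) (sym (+-identityʳ (f 0)))
  ∑<-suc (suc n) f = trans (cong (_+ f (suc n)) (∑<-suc n f)) (+-assoc (f 0) _ _)

  ∑<-split : ∀ m n f → ∑< (m ℕ.+ n) f ≡ ∑< m f + ∑< n (λ i → f (m ℕ.+ i))
  ∑<-split m zero    f = trans (cong (λ k → ∑< k f) (ℕₚ.+-identityʳ m)) (sym (+-identityʳ (∑< m f)))
  ∑<-split m (suc n) f = begin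
    ∑< (m ℕ.+ suc n) f                                  ≡⟨ cong (λ k → ∑< k f) (ℕₚ.+-suc m n) ⟩
    ∑< (m ℕ.+ n) f + f (m ℕ.+ n)                        ≡⟨ cong (_+ f (m ℕ.+ n)) (∑<-split m n f) ⟩
    (∑< m f + ∑< n (λ i → f (m ℕ.+ i))) + f (m ℕ.+ n)   ≡⟨ +-assoc (∑< m f) _ _ ⟩
    ∑< m f + ∑< (suc n) (λ i → f (m ℕ.+ i))             ∎
    where open ≡-Reasoning

  ∑<-extend : ∀ m n f → (∀ {i} → m ≤ i → i ℕ.< m ℕ.+ n → f i ≡ 0#) → ∑< (m ℕ.+ n) f ≡ ∑< m f
  ∑<-extend m n f f≗0 = trans (∑<-split m n f)
    (trans (cong (_+_ (∑< m f)) (∑<-zero n (λ i<n → f≗0 (ℕₚ.m≤m+n m _) (ℕₚ.+-monoʳ-< m i<n))))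
           (+-identityʳ (∑< m f)))

  ∑<-support : ∀ m n f → (∀ {i} → m ≤ i → f i ≡ 0#) → (∀ {i} → n ≤ i → f i ≡ 0#) →
               ∑< m f ≡ ∑< n f
  ∑<-support m n f m-supp n-supp with ℕₚ.≤-total m n
  ... | inj₁ m≤n = trans (sym (∑<-extend m (n ∸ m) f (λ m≤i _ → m-supp m≤i)))
                         (cong (λ k → ∑< k f) (ℕₚ.m+[n∸m]≡n m≤n))
  ... | inj₂ n≤m = trans (cong (λ k → ∑< k f) (sym (ℕₚ.m+[n∸m]≡n n≤m)))
                         (∑<-extend n (m ∸ n) f (λ n≤i _ → n-supp n≤i))

  ∑<-reverse : ∀ n f → ∑< n (λ i → f (n ∸ suc i)) ≡ ∑< n f
  ∑<-reverse zero    f = refl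
  ∑<-reverse (suc n) f = begin
    ∑< n (λ i → f (n ∸ i)) + f (n ∸ n)  ≡⟨ cong (λ k → ∑< n (λ i → f (n ∸ i)) + f k) (ℕₚ.n∸n≡0 n) ⟩
    ∑< n (λ i → f (n ∸ i)) + f 0        ≡⟨ cong (_+ f 0) (∑<-cong n (cong f ∘ ℕₚ.+-∸-assoc 1)) ⟩
    ∑< n (λ i → f (suc (n ∸ suc i))) + f 0 ≡⟨ cong (_+ f 0) (∑<-reverse n (f ∘ suc)) ⟩
    ∑< n (f ∘ suc) + f 0                ≡⟨ +-comm _ (f 0) ⟩
    f 0 + ∑< n (f ∘ suc)                ≡⟨ ∑<-suc n f ⟨
    ∑< (suc n) f                        ∎
    where open ≡-Reasoning

open FiniteSum (IsCommutativeRing.isCommutativeSemiring ℚₚ.+-*-isCommutativeRing)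

module ℤ∑ = FiniteSum ℤₚ.+-*-isCommutativeSemiring
module ℕ∑ = FiniteSum ℕₚ.+-*-isCommutativeSemiring

-- Polynomials

eval : Poly → ℚ → ℚ
eval []      x = 0ℚ
eval (c ∷ p) x = c + x * eval p x

coeff-+ₚ : ∀ p q j → coeff j (p +ₚ q) ≡ coeff j p + coeff j q
coeff-+ₚ []      q       j       = sym (ℚₚ.+-identityˡ (coeff j q))
coeff-+ₚ (a ∷ p) []      j       = sym (ℚₚ.+-identityʳ (coeff j (a ∷ p)))
coeff-+ₚ (a ∷ p) (b ∷ q) zero    = refl
coeff-+ₚ (a ∷ p) (b ∷ q) (suc j) = coeff-+ₚ p q j

coeff-scaleₚ : ∀ c p j → coeff j (scaleₚ c p) ≡ c * coeff j p
coeff-scaleₚ c []      j       = sym (ℚₚ.*-zeroʳ c)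
coeff-scaleₚ c (a ∷ p) zero    = refl
coeff-scaleₚ c (a ∷ p) (suc j) = coeff-scaleₚ c p j

eval-+ₚ : ∀ p q x → eval (p +ₚ q) x ≡ eval p x + eval q x
eval-+ₚ []      q       x = sym (ℚₚ.+-identityˡ (eval q x))
eval-+ₚ (a ∷ p) []      x = sym (ℚₚ.+-identityʳ (eval (a ∷ p) x))
eval-+ₚ (a ∷ p) (b ∷ q) x = trans (cong (λ v → (a + b) + x * v) (eval-+ₚ p q x)) (regroup a b x _ _)
  where
  regroup : ∀ a b x u v → (a + b) + x * (u + v) ≡ (a + x * u) + (b + x * v)
  regroup = solve-∀ ℚ-ring

eval-scaleₚ : ∀ c p x → eval (scaleₚ c p) x ≡ c * eval p x
eval-scaleₚ c []      x = sym (ℚₚ.*-zeroʳ c)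
eval-scaleₚ c (a ∷ p) x = trans (cong (λ v → c * a + x * v) (eval-scaleₚ c p x)) (regroup c a x _)
  where
  regroup : ∀ c a x u → c * a + x * (c * u) ≡ c * (a + x * u)
  regroup = solve-∀ ℚ-ring

eval-*ₚ : ∀ p q x → eval (p *ₚ q) x ≡ eval p x * eval q x
eval-*ₚ []      q x = sym (ℚₚ.*-zeroˡ (eval q x))
eval-*ₚ (a ∷ p) q x = begin
  eval (scaleₚ a q +ₚ (0ℚ ∷ (p *ₚ q))) x
    ≡⟨ eval-+ₚ (scaleₚ a q) (0ℚ ∷ (p *ₚ q)) x ⟩
  eval (scaleₚ a q) x + (0ℚ + x * eval (p *ₚ q) x)
    ≡⟨ cong₂ (λ u v → u + (0ℚ + x * v)) (eval-scaleₚ a q x) (eval-*ₚ p q x) ⟩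
  a * eval q x + (0ℚ + x * (eval p x * eval q x))
    ≡⟨ regroup a x (eval p x) (eval q x) ⟩
  (a + x * eval p x) * eval q x ∎
  where
  open ≡-Reasoning
  regroup : ∀ a x u v → a * v + (0ℚ + x * (u * v)) ≡ (a + x * u) * v
  regroup = solve-∀ ℚ-ring

Deg< : ℕ → Poly → Set
Deg< d p = ∀ {j} → d ≤ j → coeff j p ≡ 0ℚ

Deg<-+ₚ : ∀ {d} p q → Deg< d p → Deg< d q → Deg< d (p +ₚ q)
Deg<-+ₚ p q p<d q<d {j} d≤j = trans (coeff-+ₚ p q j) (trans (cong₂ _+_ (p<d d≤j) (q<d d≤j)) (ℚₚ.+-identityʳ 0ℚ))

Deg<-scaleₚ : ∀ {d} c p → Deg< d p → Deg< d (scaleₚ c p)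
Deg<-scaleₚ c p p<d {j} d≤j = trans (coeff-scaleₚ c p j) (trans (cong (c *_) (p<d d≤j)) (ℚₚ.*-zeroʳ c))

Deg<-mono : ∀ {d e} p → d ≤ e → Deg< d p → Deg< e p
Deg<-mono p d≤e p<d e≤j = p<d (ℕₚ.≤-trans d≤e e≤j)

Deg<-∷ : ∀ {d} c p → Deg< d p → Deg< (suc d) (c ∷ p)
Deg<-∷ c p p<d {suc j} (s≤s d≤j) = p<d d≤j

Deg<-tail : ∀ {d} c p → Deg< (suc d) (c ∷ p) → Deg< d p
Deg<-tail c p cp<d d≤j = cp<d (s≤s d≤j)

Deg<-length : ∀ p → Deg< (length p) p
Deg<-length []      _ = refl
Deg<-length (c ∷ p)   = Deg<-∷ c p (Deg<-length p)

shift : Poly → Poly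
shift []      = []
shift (c ∷ p) = (c ∷ []) +ₚ (shift p +ₚ (0ℚ ∷ shift p))

eval-shift : ∀ p x → eval (shift p) x ≡ eval p (1ℚ + x)
eval-shift []      x = refl
eval-shift (c ∷ p) x = begin
  eval ((c ∷ []) +ₚ (shift p +ₚ (0ℚ ∷ shift p))) x
    ≡⟨ eval-+ₚ (c ∷ []) (shift p +ₚ (0ℚ ∷ shift p)) x ⟩
  (c + x * 0ℚ) + eval (shift p +ₚ (0ℚ ∷ shift p)) x
    ≡⟨ cong (_+_ (c + x * 0ℚ)) (eval-+ₚ (shift p) (0ℚ ∷ shift p) x) ⟩
  (c + x * 0ℚ) + (eval (shift p) x + (0ℚ + x * eval (shift p) x))
    ≡⟨ cong (λ v → (c + x * 0ℚ) + (v + (0ℚ + x * v))) (eval-shift p x) ⟩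
  (c + x * 0ℚ) + (eval p (1ℚ + x) + (0ℚ + x * eval p (1ℚ + x)))
    ≡⟨ regroup c x (eval p (1ℚ + x)) ⟩
  c + (1ℚ + x) * eval p (1ℚ + x)
    ∎
  where
  open ≡-Reasoning
  regroup : ∀ c x u → (c + x * 0ℚ) + (u + (0ℚ + x * u)) ≡ c + (1ℚ + x) * u
  regroup = solve-∀ ℚ-ring

coeff-shift-∷ : ∀ c p j →
  coeff j (shift (c ∷ p)) ≡ coeff j (c ∷ []) + (coeff j (shift p) + coeff j (0ℚ ∷ shift p))
coeff-shift-∷ c p j = trans (coeff-+ₚ (c ∷ []) (shift p +ₚ (0ℚ ∷ shift p)) j)
  (cong (_+_ (coeff j (c ∷ []))) (coeff-+ₚ (shift p) (0ℚ ∷ shift p) j))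

coeff-shift-length : ∀ p j → coeff j (shift p) ≡ ∑< (length p) (λ i → ℕtoℚ (i C j) * coeff i p)
coeff-shift-length []      j       = refl
coeff-shift-length (c ∷ p) zero    = begin
  coeff 0 (shift (c ∷ p))
    ≡⟨ coeff-shift-∷ c p 0 ⟩
  c + (coeff 0 (shift p) + 0ℚ)
    ≡⟨ cong (_+_ c) (ℚₚ.+-identityʳ _) ⟩
  c + coeff 0 (shift p)
    ≡⟨ cong₂ _+_ (sym (ℚₚ.*-identityˡ c)) (coeff-shift-length p 0) ⟩
  ℕtoℚ 1 * c + ∑< (length p) (λ i → ℕtoℚ 1 * coeff i p)
    ≡⟨ ∑<-suc (length p) _ ⟨
  ∑< (suc (length p)) (λ i → ℕtoℚ (i C 0) * coeff i (c ∷ p)) ∎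
  where open ≡-Reasoning
coeff-shift-length (c ∷ p) (suc j) = begin
  coeff (suc j) (shift (c ∷ p))
    ≡⟨ coeff-shift-∷ c p (suc j) ⟩
  0ℚ + (coeff (suc j) (shift p) + coeff j (shift p))
    ≡⟨ ℚₚ.+-identityˡ _ ⟩
  coeff (suc j) (shift p) + coeff j (shift p)
    ≡⟨ cong₂ _+_ (coeff-shift-length p (suc j)) (coeff-shift-length p j) ⟩
  ∑< (length p) (λ i → ℕtoℚ (i C suc j) * coeff i p) + ∑< (length p) (λ i → ℕtoℚ (i C j) * coeff i p)
    ≡⟨ ∑<-+ (length p) (λ i → ℕtoℚ (i C suc j) * coeff i p) (λ i → ℕtoℚ (i C j) * coeff i p) ⟨
  ∑< (length p) (λ i → ℕtoℚ (i C suc j) * coeff i p + ℕtoℚ (i C j) * coeff i p)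
    ≡⟨ ∑<-cong (length p) (λ {i} _ → pascal i) ⟩
  ∑< (length p) (λ i → ℕtoℚ (suc i C suc j) * coeff i p)
    ≡⟨ ℚₚ.+-identityˡ _ ⟨
  0ℚ + ∑< (length p) (λ i → ℕtoℚ (suc i C suc j) * coeff i p)
    ≡⟨ cong (_+ ∑< (length p) (λ i → ℕtoℚ (suc i C suc j) * coeff i p)) (ℚₚ.*-zeroˡ c) ⟨
  ℕtoℚ (0 C suc j) * c + ∑< (length p) (λ i → ℕtoℚ (suc i C suc j) * coeff i p)
    ≡⟨ ∑<-suc (length p) _ ⟨
  ∑< (suc (length p)) (λ i → ℕtoℚ (i C suc j) * coeff i (c ∷ p))
    ∎
  where
  open ≡-Reasoning
  pascal : ∀ i → ℕtoℚ (i C suc j) * coeff i p + ℕtoℚ (i C j) * coeff i p ≡ ℕtoℚ (suc i C suc j) * coeff i p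
  pascal i = begin
    ℕtoℚ (i C suc j) * coeff i p + ℕtoℚ (i C j) * coeff i p
      ≡⟨ ℚₚ.*-distribʳ-+ (coeff i p) (ℕtoℚ (i C suc j)) (ℕtoℚ (i C j)) ⟨
    (ℕtoℚ (i C suc j) + ℕtoℚ (i C j)) * coeff i p
      ≡⟨ cong (_* coeff i p) (ℚₚ.+-comm (ℕtoℚ (i C suc j)) (ℕtoℚ (i C j))) ⟩
    (ℕtoℚ (i C j) + ℕtoℚ (i C suc j)) * coeff i p
      ≡⟨ cong (_* coeff i p) (ℕtoℚ-homo-+ (i C j) (i C suc j)) ⟨
    ℕtoℚ (i C j ℕ.+ i C suc j) * coeff i p
      ≡⟨ cong (λ k → ℕtoℚ k * coeff i p) (nCk+nC[k+1]≡[n+1]C[k+1] i j) ⟩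
    ℕtoℚ (suc i C suc j) * coeff i p ∎

coeff-shift : ∀ {N} p j → Deg< N p → coeff j (shift p) ≡ ∑< N (λ i → ℕtoℚ (i C j) * coeff i p)
coeff-shift {N} p j p<N = trans (coeff-shift-length p j)
  (∑<-support (length p) N (λ i → ℕtoℚ (i C j) * coeff i p)
              (λ len≤i → vanish (Deg<-length p len≤i)) (λ N≤i → vanish (p<N N≤i)))
  where
  vanish : ∀ {i} → coeff i p ≡ 0ℚ → ℕtoℚ (i C j) * coeff i p ≡ 0ℚ
  vanish {i} pᵢ≡0 = trans (cong (ℕtoℚ (i C j) *_) pᵢ≡0) (ℚₚ.*-zeroʳ (ℕtoℚ (i C j)))

Δ : Poly → Poly
Δ p = shift p +ₚ scaleₚ (- 1ℚ) p

coeff-Δ : ∀ p j → coeff j (Δ p) ≡ coeff j (shift p) - coeff j p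
coeff-Δ p j = trans (coeff-+ₚ (shift p) (scaleₚ (- 1ℚ) p) j)
  (trans (cong (_+_ (coeff j (shift p))) (coeff-scaleₚ (- 1ℚ) p j)) (minus (coeff j (shift p)) (coeff j p)))
  where
  minus : ∀ a b → a + (- 1ℚ) * b ≡ a - b
  minus = solve-∀ ℚ-ring

eval-Δ : ∀ p x → eval (Δ p) x ≡ eval p (1ℚ + x) - eval p x
eval-Δ p x = trans (eval-+ₚ (shift p) (scaleₚ (- 1ℚ) p) x)
  (trans (cong₂ _+_ (eval-shift p x) (eval-scaleₚ (- 1ℚ) p x)) (minus (eval p (1ℚ + x)) (eval p x)))
  where
  minus : ∀ a b → a + (- 1ℚ) * b ≡ a - b
  minus = solve-∀ ℚ-ring

coeff-shift-top : ∀ {d} p j → Deg< (suc d) p → d ≤ j → coeff j (shift p) ≡ coeff j p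
coeff-shift-top {d} p j p<1+d d≤j = begin
  coeff j (shift p)
    ≡⟨ coeff-shift p j p<1+d ⟩
  ∑< d (λ i → ℕtoℚ (i C j) * coeff i p) + ℕtoℚ (d C j) * coeff d p
    ≡⟨ cong (_+ ℕtoℚ (d C j) * coeff d p) lower ⟩
  0ℚ + ℕtoℚ (d C j) * coeff d p
    ≡⟨ ℚₚ.+-identityˡ _ ⟩
  ℕtoℚ (d C j) * coeff d p
    ≡⟨ top (ℕₚ.m≤n⇒m<n∨m≡n d≤j) ⟩
  coeff j p ∎
  where
  open ≡-Reasoning
  lower : ∑< d (λ i → ℕtoℚ (i C j) * coeff i p) ≡ 0ℚ
  lower = ∑<-zero d (λ {i} i<d → trans (cong (λ k → ℕtoℚ k * coeff i p) (k>n⇒nCk≡0 (ℕₚ.<-≤-trans i<d d≤j)))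
                                        (ℚₚ.*-zeroˡ (coeff i p)))
  top : d ℕ.< j ⊎ d ≡ j → ℕtoℚ (d C j) * coeff d p ≡ coeff j p
  top (inj₁ d<j)  = trans (cong (λ k → ℕtoℚ k * coeff d p) (k>n⇒nCk≡0 d<j))
                          (trans (ℚₚ.*-zeroˡ (coeff d p)) (sym (p<1+d d<j)))
  top (inj₂ refl) = trans (cong (λ k → ℕtoℚ k * coeff d p) (nCn≡1 d)) (ℚₚ.*-identityˡ (coeff d p))

Deg<-Δ : ∀ {d} p → Deg< (suc d) p → Deg< d (Δ p)
Deg<-Δ p p<1+d {j} d≤j = trans (coeff-Δ p j)
  (trans (cong (_- coeff j p) (coeff-shift-top p j p<1+d d≤j)) (ℚₚ.+-inverseʳ (coeff j p)))

coeff-Δ-+ₚ-scaleₚ : ∀ {N} p q c j → Deg< N p → Deg< N q →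
  coeff j (Δ (p +ₚ scaleₚ c q)) ≡ coeff j (Δ p) + c * coeff j (Δ q)
coeff-Δ-+ₚ-scaleₚ {N} p q c j p<N q<N = begin
  coeff j (Δ (p +ₚ scaleₚ c q))
    ≡⟨ coeff-Δ (p +ₚ scaleₚ c q) j ⟩
  coeff j (shift (p +ₚ scaleₚ c q)) - coeff j (p +ₚ scaleₚ c q)
    ≡⟨ cong₂ _-_ (coeff-shift (p +ₚ scaleₚ c q) j p+cq<N) (pointwise j) ⟩
  ∑< N (λ i → ℕtoℚ (i C j) * coeff i (p +ₚ scaleₚ c q)) - (coeff j p + c * coeff j q)
    ≡⟨ cong (_- (coeff j p + c * coeff j q)) (∑<-cong N (λ {i} _ → distribute i)) ⟩
  ∑< N (λ i → ℕtoℚ (i C j) * coeff i p + c * (ℕtoℚ (i C j) * coeff i q)) - (coeff j p + c * coeff j q)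
    ≡⟨ cong (_- (coeff j p + c * coeff j q))
            (trans (∑<-+ N (λ i → ℕtoℚ (i C j) * coeff i p) (λ i → c * (ℕtoℚ (i C j) * coeff i q)))
                   (cong (_+_ Sp) (∑<-*ˡ N c (λ i → ℕtoℚ (i C j) * coeff i q)))) ⟩
  (Sp + c * Sq) - (coeff j p + c * coeff j q)
    ≡⟨ regroup Sp Sq c (coeff j p) (coeff j q) ⟩
  (Sp - coeff j p) + c * (Sq - coeff j q)
    ≡⟨ cong₂ (λ u v → (u - coeff j p) + c * (v - coeff j q)) (coeff-shift p j p<N) (coeff-shift q j q<N) ⟨
  (coeff j (shift p) - coeff j p) + c * (coeff j (shift q) - coeff j q)
    ≡⟨ cong₂ (λ u v → u + c * v) (coeff-Δ p j) (coeff-Δ q j) ⟨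
  coeff j (Δ p) + c * coeff j (Δ q)
    ∎
  where
  open ≡-Reasoning
  Sp = ∑< N (λ i → ℕtoℚ (i C j) * coeff i p)
  Sq = ∑< N (λ i → ℕtoℚ (i C j) * coeff i q)
  p+cq<N = Deg<-+ₚ p (scaleₚ c q) p<N (Deg<-scaleₚ c q q<N)
  pointwise : ∀ i → coeff i (p +ₚ scaleₚ c q) ≡ coeff i p + c * coeff i q
  pointwise i = trans (coeff-+ₚ p (scaleₚ c q) i) (cong (_+_ (coeff i p)) (coeff-scaleₚ c q i))
  distribute : ∀ i → ℕtoℚ (i C j) * coeff i (p +ₚ scaleₚ c q)
                   ≡ ℕtoℚ (i C j) * coeff i p + c * (ℕtoℚ (i C j) * coeff i q)
  distribute i = trans (cong (ℕtoℚ (i C j) *_) (pointwise i)) (ring (ℕtoℚ (i C j)) c (coeff i p) (coeff i q))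
    where
    ring : ∀ b c u v → b * (u + c * v) ≡ b * u + c * (b * v)
    ring = solve-∀ ℚ-ring
  regroup : ∀ s t c u v → (s + c * t) - (u + c * v) ≡ (s - u) + c * (t - v)
  regroup = solve-∀ ℚ-ring

[1+n]Cn≡1+n : ∀ j → suc j C j ≡ suc j
[1+n]Cn≡1+n j = trans (nCk≡nC[n∸k] (ℕₚ.n≤1+n j)) (trans (cong (suc j C_) (ℕₚ.m+n∸n≡m 1 j)) (nC1≡n (suc j)))

coeff-Δ-expand : ∀ {N} p j → Deg< (suc N) p → j ℕ.< N →
  coeff j (Δ p) ≡ ℕtoℚ (suc j) * coeff (suc j) p
                + ∑< (N ∸ suc j) (λ k → ℕtoℚ ((suc (suc j) ℕ.+ k) C j) * coeff (suc (suc j) ℕ.+ k) p)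
coeff-Δ-expand {N} p j p<1+N j<N = begin
  coeff j (Δ p)
    ≡⟨ coeff-Δ p j ⟩
  coeff j (shift p) - coeff j p
    ≡⟨ cong (_- coeff j p) (coeff-shift p j p<1+N) ⟩
  ∑< (suc N) g - coeff j p
    ≡⟨ cong (λ n → ∑< n g - coeff j p) (ℕₚ.m+[n∸m]≡n (s≤s j<N)) ⟨
  ∑< (suc (suc j) ℕ.+ (N ∸ suc j)) g - coeff j p
    ≡⟨ cong (_- coeff j p) (∑<-split (suc (suc j)) (N ∸ suc j) g) ⟩
  (((∑< j g + g j) + g (suc j)) + tail) - coeff j p
    ≡⟨ cong₂ (λ u v → ((u + v) + tail) - coeff j p) (cong₂ _+_ below diagonal) next ⟩
  (((0ℚ + coeff j p) + ℕtoℚ (suc j) * coeff (suc j) p) + tail) - coeff j p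
    ≡⟨ regroup (coeff j p) (ℕtoℚ (suc j) * coeff (suc j) p) tail ⟩
  ℕtoℚ (suc j) * coeff (suc j) p + tail ∎
  where
  open ≡-Reasoning
  g : ℕ → ℚ
  g i = ℕtoℚ (i C j) * coeff i p
  tail = ∑< (N ∸ suc j) (λ k → g (suc (suc j) ℕ.+ k))
  below : ∑< j g ≡ 0ℚ
  below = ∑<-zero j (λ {i} i<j →
    trans (cong (λ c → ℕtoℚ c * coeff i p) (k>n⇒nCk≡0 i<j)) (ℚₚ.*-zeroˡ (coeff i p)))
  diagonal : g j ≡ coeff j p
  diagonal = trans (cong (λ c → ℕtoℚ c * coeff j p) (nCn≡1 j)) (ℚₚ.*-identityˡ (coeff j p))
  next : g (suc j) ≡ ℕtoℚ (suc j) * coeff (suc j) p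
  next = cong (λ c → ℕtoℚ c * coeff (suc j) p) ([1+n]Cn≡1+n j)
  regroup : ∀ x y z → (((0ℚ + x) + y) + z) - x ≡ y + z
  regroup = solve-∀ ℚ-ring

coeff-applyUpTo : ∀ (f : ℕ → ℚ) n {i} → i ℕ.< n → coeff i (applyUpTo f n) ≡ f i
coeff-applyUpTo f (suc n) {zero}  _         = refl
coeff-applyUpTo f (suc n) {suc i} (s≤s i<n) = coeff-applyUpTo (f ∘ suc) n i<n

Deg<-applyUpTo : ∀ (f : ℕ → ℚ) n → Deg< n (applyUpTo f n)
Deg<-applyUpTo f n = subst (λ d → Deg< d (applyUpTo f n)) (length-applyUpTo f n) (Deg<-length (applyUpTo f n))

divRoot : ℚ → Poly → Poly
divRoot r []      = []
divRoot r (c ∷ p) = p +ₚ scaleₚ r (divRoot r p)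

coeff-divRoot : ∀ r c p j → coeff j (divRoot r (c ∷ p)) ≡ coeff j p + r * coeff j (divRoot r p)
coeff-divRoot r c p j = trans (coeff-+ₚ p (scaleₚ r (divRoot r p)) j)
  (cong (_+_ (coeff j p)) (coeff-scaleₚ r (divRoot r p) j))

eval-divRoot : ∀ r p y → eval p y ≡ eval p r + (y - r) * eval (divRoot r p) y
eval-divRoot r []      y = sym (trans (ℚₚ.+-identityˡ _) (ℚₚ.*-zeroʳ (y - r)))
eval-divRoot r (c ∷ p) y = begin
  c + y * eval p y
    ≡⟨ cong (λ v → c + y * v) (eval-divRoot r p y) ⟩
  c + y * (eval p r + (y - r) * eval q y)
    ≡⟨ regroup c y r (eval p r) (eval q y) ⟩
  (c + r * eval p r) + (y - r) * ((eval p r + (y - r) * eval q y) + r * eval q y)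
    ≡⟨ cong (λ v → (c + r * eval p r) + (y - r) * (v + r * eval q y)) (eval-divRoot r p y) ⟨
  (c + r * eval p r) + (y - r) * (eval p y + r * eval q y)
    ≡⟨ cong (λ v → (c + r * eval p r) + (y - r) * v)
         (trans (eval-+ₚ p (scaleₚ r q) y) (cong (_+_ (eval p y)) (eval-scaleₚ r q y))) ⟨
  (c + r * eval p r) + (y - r) * eval (divRoot r (c ∷ p)) y
    ∎
  where
  open ≡-Reasoning
  q = divRoot r p
  regroup : ∀ c y r u v → c + y * (u + (y - r) * v) ≡ (c + r * u) + (y - r) * ((u + (y - r) * v) + r * v)
  regroup = solve-∀ ℚ-ring

coeff-divRoot-zero : ∀ r p → coeff 0 p ≡ eval p r - r * coeff 0 (divRoot r p)
coeff-divRoot-zero r []      = sym (trans (cong (_-_ 0ℚ) (ℚₚ.*-zeroʳ r)) (ℚₚ.+-inverseʳ 0ℚ))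
coeff-divRoot-zero r (c ∷ p) = begin
  c
    ≡⟨ regroup c r (eval p r) q₀ ⟩
  (c + r * eval p r) - r * ((eval p r - r * q₀) + r * q₀)
    ≡⟨ cong (λ v → (c + r * eval p r) - r * (v + r * q₀)) (coeff-divRoot-zero r p) ⟨
  (c + r * eval p r) - r * (coeff 0 p + r * q₀)
    ≡⟨ cong (λ v → (c + r * eval p r) - r * v) (coeff-divRoot r c p 0) ⟨
  (c + r * eval p r) - r * coeff 0 (divRoot r (c ∷ p)) ∎
  where
  open ≡-Reasoning
  q₀ = coeff 0 (divRoot r p)
  regroup : ∀ c r u v → c ≡ (c + r * u) - r * ((u - r * v) + r * v)
  regroup = solve-∀ ℚ-ring

coeff-divRoot-suc : ∀ r p j → coeff (suc j) p ≡ coeff j (divRoot r p) - r * coeff (suc j) (divRoot r p)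
coeff-divRoot-suc r []      j = sym (trans (cong (_-_ 0ℚ) (ℚₚ.*-zeroʳ r)) (ℚₚ.+-inverseʳ 0ℚ))
coeff-divRoot-suc r (c ∷ p) j = begin
  coeff j p
    ≡⟨ regroup (coeff j p) r qⱼ q₁₊ⱼ ⟩
  (coeff j p + r * qⱼ) - r * ((qⱼ - r * q₁₊ⱼ) + r * q₁₊ⱼ)
    ≡⟨ cong (λ v → (coeff j p + r * qⱼ) - r * (v + r * q₁₊ⱼ)) (coeff-divRoot-suc r p j) ⟨
  (coeff j p + r * qⱼ) - r * (coeff (suc j) p + r * q₁₊ⱼ)
    ≡⟨ cong₂ (λ u v → u - r * v) (coeff-divRoot r c p j) (coeff-divRoot r c p (suc j)) ⟨
  coeff j (divRoot r (c ∷ p)) - r * coeff (suc j) (divRoot r (c ∷ p)) ∎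
  where
  open ≡-Reasoning
  qⱼ   = coeff j (divRoot r p)
  q₁₊ⱼ = coeff (suc j) (divRoot r p)
  regroup : ∀ a r u v → a ≡ (a + r * u) - r * ((u - r * v) + r * v)
  regroup = solve-∀ ℚ-ring

Deg<-divRoot : ∀ {d} r p → Deg< (suc d) p → Deg< d (divRoot r p)
Deg<-divRoot r []      _      _ = refl
Deg<-divRoot r (c ∷ p) cp<1+d {j} d≤j = trans (coeff-divRoot r c p j)
  (trans (cong₂ (λ u v → u + r * v) (p<d d≤j) (Deg<-divRoot r p (Deg<-mono p (ℕₚ.n≤1+n _) p<d) d≤j))
         (trans (cong (_+_ 0ℚ) (ℚₚ.*-zeroʳ r)) (ℚₚ.+-identityʳ 0ℚ)))
  where
  p<d = Deg<-tail c p cp<1+d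

roots⇒coeff≡0 : ∀ d p r → Deg< d p → (∀ {x} → x ℕ.< d → eval p (ℕtoℚ (r ℕ.+ x)) ≡ 0ℚ) →
                ∀ j → coeff j p ≡ 0ℚ
roots⇒coeff≡0 zero    p r p<0 _    j = p<0 z≤n
roots⇒coeff≡0 (suc d) p r p<1+d roots = coeff≡0
  where
  q = divRoot (ℕtoℚ r) p
  p[r]≡0 : eval p (ℕtoℚ r) ≡ 0ℚ
  p[r]≡0 = trans (cong (λ k → eval p (ℕtoℚ k)) (sym (ℕₚ.+-identityʳ r))) (roots (s≤s z≤n))
  q-roots : ∀ {x} → x ℕ.< d → eval q (ℕtoℚ (suc r ℕ.+ x)) ≡ 0ℚ
  q-roots {x} x<d = ℕtoℚ-*-cancelˡ (suc x) (begin
    ℕtoℚ (suc x) * eval q y                     ≡⟨ cong (_* eval q y) gap ⟨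
    (y - ℕtoℚ r) * eval q y                     ≡⟨ ℚₚ.+-identityˡ _ ⟨
    0ℚ + (y - ℕtoℚ r) * eval q y                ≡⟨ cong (_+ (y - ℕtoℚ r) * eval q y) p[r]≡0 ⟨
    eval p (ℕtoℚ r) + (y - ℕtoℚ r) * eval q y   ≡⟨ eval-divRoot (ℕtoℚ r) p y ⟨
    eval p y                                    ≡⟨ cong (λ k → eval p (ℕtoℚ k)) (ℕₚ.+-suc r x) ⟨
    eval p (ℕtoℚ (r ℕ.+ suc x))                 ≡⟨ roots (s≤s x<d) ⟩
    0ℚ                                          ≡⟨ ℚₚ.*-zeroʳ (ℕtoℚ (suc x)) ⟨
    ℕtoℚ (suc x) * 0ℚ                           ∎)
    where
    open ≡-Reasoning
    y = ℕtoℚ (suc r ℕ.+ x)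
    gap : y - ℕtoℚ r ≡ ℕtoℚ (suc x)
    gap = trans (cong (_- ℕtoℚ r) (trans (cong ℕtoℚ (sym (ℕₚ.+-suc r x))) (ℕtoℚ-homo-+ r (suc x))))
                (cancel (ℕtoℚ r) (ℕtoℚ (suc x)))
      where
      cancel : ∀ a b → (a + b) - a ≡ b
      cancel = solve-∀ ℚ-ring
  q≡0 : ∀ j → coeff j q ≡ 0ℚ
  q≡0 = roots⇒coeff≡0 d q (suc r) (Deg<-divRoot (ℕtoℚ r) p p<1+d) q-roots
  cancel : ∀ r → 0ℚ - r * 0ℚ ≡ 0ℚ
  cancel = solve-∀ ℚ-ring
  coeff≡0 : ∀ j → coeff j p ≡ 0ℚ
  coeff≡0 zero    = trans (coeff-divRoot-zero (ℕtoℚ r) p)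
    (trans (cong₂ (λ u v → u - ℕtoℚ r * v) p[r]≡0 (q≡0 0)) (cancel (ℕtoℚ r)))
  coeff≡0 (suc j) = trans (coeff-divRoot-suc (ℕtoℚ r) p j)
    (trans (cong₂ (λ u v → u - ℕtoℚ r * v) (q≡0 j) (q≡0 (suc j))) (cancel (ℕtoℚ r)))

coeff≡-from-values : ∀ d p q → Deg< d p → Deg< d q →
  (∀ {x} → x ℕ.< d → eval p (ℕtoℚ x) ≡ eval q (ℕtoℚ x)) → ∀ j → coeff j p ≡ coeff j q
coeff≡-from-values d p q p<d q<d p≗q j = begin
  coeff j p                               ≡⟨ regroup (coeff j p) (coeff j q) ⟩
  (coeff j p + (- 1ℚ) * coeff j q) + coeff j q
    ≡⟨ cong (_+ coeff j q) (trans (sym (coeff-p-q j)) (roots⇒coeff≡0 d p-q 0 p-q<d p-q-roots j)) ⟩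
  0ℚ + coeff j q                          ≡⟨ ℚₚ.+-identityˡ (coeff j q) ⟩
  coeff j q                               ∎
  where
  open ≡-Reasoning
  p-q = p +ₚ scaleₚ (- 1ℚ) q
  p-q<d = Deg<-+ₚ p (scaleₚ (- 1ℚ) q) p<d (Deg<-scaleₚ (- 1ℚ) q q<d)
  coeff-p-q : ∀ j → coeff j p-q ≡ coeff j p + (- 1ℚ) * coeff j q
  coeff-p-q j = trans (coeff-+ₚ p (scaleₚ (- 1ℚ) q) j) (cong (_+_ (coeff j p)) (coeff-scaleₚ (- 1ℚ) q j))
  p-q-roots : ∀ {x} → x ℕ.< d → eval p-q (ℕtoℚ (0 ℕ.+ x)) ≡ 0ℚ
  p-q-roots {x} x<d = trans (eval-+ₚ p (scaleₚ (- 1ℚ) q) (ℕtoℚ x))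
    (trans (cong₂ _+_ (p≗q x<d) (eval-scaleₚ (- 1ℚ) q (ℕtoℚ x))) (cancel (eval q (ℕtoℚ x))))
    where
    cancel : ∀ v → v + (- 1ℚ) * v ≡ 0ℚ
    cancel = solve-∀ ℚ-ring
  regroup : ∀ u v → u ≡ (u + (- 1ℚ) * v) + v
  regroup = solve-∀ ℚ-ring

coeff-zero-*ₚ-linear : ∀ p e → coeff 0 (p *ₚ (e ∷ 1ℚ ∷ [])) ≡ e * coeff 0 p
coeff-zero-*ₚ-linear []      e = sym (ℚₚ.*-zeroʳ e)
coeff-zero-*ₚ-linear (a ∷ p) e = trans (ℚₚ.+-identityʳ (a * e)) (ℚₚ.*-comm a e)

coeff-suc-*ₚ-linear : ∀ p e j → coeff (suc j) (p *ₚ (e ∷ 1ℚ ∷ [])) ≡ e * coeff (suc j) p + coeff j p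
coeff-suc-*ₚ-linear []      e j       = sym (trans (ℚₚ.+-identityʳ (e * 0ℚ)) (ℚₚ.*-zeroʳ e))
coeff-suc-*ₚ-linear (a ∷ p) e zero    = begin
  coeff 0 ((a * 1ℚ ∷ []) +ₚ (p *ₚ (e ∷ 1ℚ ∷ [])))    ≡⟨ coeff-+ₚ (a * 1ℚ ∷ []) (p *ₚ (e ∷ 1ℚ ∷ [])) 0 ⟩
  a * 1ℚ + coeff 0 (p *ₚ (e ∷ 1ℚ ∷ []))             ≡⟨ cong (_+_ (a * 1ℚ)) (coeff-zero-*ₚ-linear p e) ⟩
  a * 1ℚ + e * coeff 0 p                            ≡⟨ regroup a e (coeff 0 p) ⟩
  e * coeff 0 p + a                                 ∎
  where
  open ≡-Reasoning
  regroup : ∀ a e u → a * 1ℚ + e * u ≡ e * u + a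
  regroup = solve-∀ ℚ-ring
coeff-suc-*ₚ-linear (a ∷ p) e (suc j) = begin
  coeff (suc j) ((a * 1ℚ ∷ []) +ₚ (p *ₚ (e ∷ 1ℚ ∷ [])))
    ≡⟨ coeff-+ₚ (a * 1ℚ ∷ []) (p *ₚ (e ∷ 1ℚ ∷ [])) (suc j) ⟩
  0ℚ + coeff (suc j) (p *ₚ (e ∷ 1ℚ ∷ []))
    ≡⟨ ℚₚ.+-identityˡ _ ⟩
  coeff (suc j) (p *ₚ (e ∷ 1ℚ ∷ []))
    ≡⟨ coeff-suc-*ₚ-linear p e j ⟩
  e * coeff (suc j) p + coeff j p ∎
  where open ≡-Reasoning

Monic : ℕ → Poly → Set
Monic n p = Deg< (suc n) p × coeff n p ≡ 1ℚ

Monic-*ₚ-linear : ∀ {n} p e → Monic n p → Monic (suc n) (p *ₚ (e ∷ 1ℚ ∷ []))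
Monic-*ₚ-linear {n} p e (p<1+n , pₙ≡1) = pe<2+n , peₙ₊₁≡1
  where
  pe<2+n : Deg< (suc (suc n)) (p *ₚ (e ∷ 1ℚ ∷ []))
  pe<2+n {suc j} (s≤s 1+n≤j) = trans (coeff-suc-*ₚ-linear p e j)
    (trans (cong₂ (λ u v → e * u + v) (p<1+n (ℕₚ.m≤n⇒m≤1+n 1+n≤j)) (p<1+n 1+n≤j))
           (trans (ℚₚ.+-identityʳ (e * 0ℚ)) (ℚₚ.*-zeroʳ e)))
  peₙ₊₁≡1 : coeff (suc n) (p *ₚ (e ∷ 1ℚ ∷ [])) ≡ 1ℚ
  peₙ₊₁≡1 = trans (coeff-suc-*ₚ-linear p e n)
    (trans (cong₂ (λ u v → e * u + v) (p<1+n ℕₚ.≤-refl) pₙ≡1)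
           (trans (cong (_+ 1ℚ) (ℚₚ.*-zeroʳ e)) (ℚₚ.+-identityˡ 1ℚ)))

fallingProd-monic : ∀ c n → Monic n (fallingProd c n)
fallingProd-monic c zero    = (λ { {suc j} _ → refl }) , refl
fallingProd-monic c (suc n) = Monic-*ₚ-linear (fallingProd c n) _ (fallingProd-monic c n)

invFact : ℕ → ℚ
invFact n = ((+ 1) / n !) {{n !≢0}}

binomPoly-Deg< : ∀ c n → Deg< (suc n) (binomPoly c n)
binomPoly-Deg< c n = Deg<-scaleₚ (invFact n) (fallingProd c n) (proj₁ (fallingProd-monic c n))

binomPoly-leading : ∀ c n → coeff n (binomPoly c n) ≡ invFact n
binomPoly-leading c n = trans (coeff-scaleₚ (invFact n) (fallingProd c n) n)
  (trans (cong (invFact n *_) (proj₂ (fallingProd-monic c n))) (ℚₚ.*-identityʳ (invFact n)))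

fallingℤ : ℤ → ℕ → ℤ
fallingℤ z zero    = + 1
fallingℤ z (suc n) = fallingℤ z n ℤ.* (z ℤ.- + n)

C-absorption : ∀ N k → + suc k ℤ.* + (N C suc k) ≡ (+ N ℤ.- + k) ℤ.* + (N C k)
C-absorption zero    zero    = refl
C-absorption zero    (suc k) = trans (ℤₚ.*-zeroʳ (+ suc (suc k))) (sym (ℤₚ.*-zeroʳ (+ 0 ℤ.- + suc k)))
C-absorption (suc N) zero    = trans (cong (λ c → + 1 ℤ.* + c) (nC1≡n (suc N))) (shape (+ suc N))
  where
  shape : ∀ x → + 1 ℤ.* x ≡ (x ℤ.- + 0) ℤ.* + 1
  shape = ℤ-Solver.solve-∀
C-absorption (suc N) (suc k) = begin
  + suc (suc k) ℤ.* + (suc N C suc (suc k))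
    ≡⟨ cong (λ c → + suc (suc k) ℤ.* + c) (nCk+nC[k+1]≡[n+1]C[k+1] N (suc k)) ⟨
  + suc (suc k) ℤ.* (Y ℤ.+ Z)
    ≡⟨ ℤₚ.*-distribˡ-+ (+ suc (suc k)) Y Z ⟩
  + suc (suc k) ℤ.* Y ℤ.+ + suc (suc k) ℤ.* Z
    ≡⟨ cong (ℤ._+_ (+ suc (suc k) ℤ.* Y)) (C-absorption N (suc k)) ⟩
  + suc (suc k) ℤ.* Y ℤ.+ (+ N ℤ.- + suc k) ℤ.* Y
    ≡⟨ regroup (+ k) (+ N) Y ⟩
  + suc k ℤ.* Y ℤ.+ (+ N ℤ.- + k) ℤ.* Y
    ≡⟨ cong (ℤ._+ (+ N ℤ.- + k) ℤ.* Y) (C-absorption N k) ⟩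
  (+ N ℤ.- + k) ℤ.* X ℤ.+ (+ N ℤ.- + k) ℤ.* Y
    ≡⟨ factor (+ k) (+ N) X Y ⟩
  (+ suc N ℤ.- + suc k) ℤ.* (X ℤ.+ Y)
    ≡⟨ cong (λ c → (+ suc N ℤ.- + suc k) ℤ.* + c) (nCk+nC[k+1]≡[n+1]C[k+1] N k) ⟩
  (+ suc N ℤ.- + suc k) ℤ.* + (suc N C suc k) ∎
  where
  open ≡-Reasoning
  X = + (N C k)
  Y = + (N C suc k)
  Z = + (N C suc (suc k))
  regroup : ∀ k N Y → (+ 2 ℤ.+ k) ℤ.* Y ℤ.+ (N ℤ.- (+ 1 ℤ.+ k)) ℤ.* Y ≡ (+ 1 ℤ.+ k) ℤ.* Y ℤ.+ (N ℤ.- k) ℤ.* Y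
  regroup = ℤ-Solver.solve-∀
  factor : ∀ k N X Y → (N ℤ.- k) ℤ.* X ℤ.+ (N ℤ.- k) ℤ.* Y ≡ ((+ 1 ℤ.+ N) ℤ.- (+ 1 ℤ.+ k)) ℤ.* (X ℤ.+ Y)
  factor = ℤ-Solver.solve-∀

fallingℤ-C : ∀ N n → fallingℤ (+ N) n ≡ + (n !) ℤ.* + (N C n)
fallingℤ-C N zero    = refl
fallingℤ-C N (suc n) = begin
  fallingℤ (+ N) n ℤ.* (+ N ℤ.- + n)
    ≡⟨ cong (ℤ._* (+ N ℤ.- + n)) (fallingℤ-C N n) ⟩
  + (n !) ℤ.* + (N C n) ℤ.* (+ N ℤ.- + n)
    ≡⟨ regroup (+ (n !)) (+ (N C n)) (+ N ℤ.- + n) ⟩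
  + (n !) ℤ.* ((+ N ℤ.- + n) ℤ.* + (N C n))
    ≡⟨ cong (+ (n !) ℤ.*_) (C-absorption N n) ⟨
  + (n !) ℤ.* (+ suc n ℤ.* + (N C suc n))
    ≡⟨ ℤₚ.*-assoc (+ (n !)) (+ suc n) (+ (N C suc n)) ⟨
  + (n !) ℤ.* + suc n ℤ.* + (N C suc n)
    ≡⟨ cong (ℤ._* + (N C suc n)) (ℤₚ.*-comm (+ (n !)) (+ suc n)) ⟩
  + suc n ℤ.* + (n !) ℤ.* + (N C suc n)
    ≡⟨ cong (ℤ._* + (N C suc n)) (ℤₚ.pos-* (suc n) (n !)) ⟨
  + (suc n !) ℤ.* + (N C suc n) ∎
  where
  open ≡-Reasoning
  regroup : ∀ f c d → f ℤ.* c ℤ.* d ≡ f ℤ.* (d ℤ.* c)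
  regroup = ℤ-Solver.solve-∀

eval-fallingProd : ∀ c n x → eval (fallingProd c n) (ℕtoℚ x) ≡ ℤtoℚ (fallingℤ (+ (x ℕ.+ c)) n)
eval-fallingProd c zero    x = trans (cong (_+_ 1ℚ) (ℚₚ.*-zeroʳ (ℕtoℚ x))) (ℚₚ.+-identityʳ 1ℚ)
eval-fallingProd c (suc n) x = begin
  eval (fallingProd c n *ₚ (e ∷ 1ℚ ∷ [])) (ℕtoℚ x)
    ≡⟨ eval-*ₚ (fallingProd c n) (e ∷ 1ℚ ∷ []) (ℕtoℚ x) ⟩
  eval (fallingProd c n) (ℕtoℚ x) * (e + ℕtoℚ x * (1ℚ + ℕtoℚ x * 0ℚ))
    ≡⟨ cong₂ _*_ (eval-fallingProd c n x) (linear e (ℕtoℚ x)) ⟩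
  ℤtoℚ (fallingℤ (+ (x ℕ.+ c)) n) * (e + ℕtoℚ x)
    ≡⟨ cong (ℤtoℚ (fallingℤ (+ (x ℕ.+ c)) n) *_) (ℤtoℚ-homo-+ (+ c ℤ.- + n) (+ x)) ⟨
  ℤtoℚ (fallingℤ (+ (x ℕ.+ c)) n) * ℤtoℚ ((+ c ℤ.- + n) ℤ.+ + x)
    ≡⟨ cong (λ z → ℤtoℚ (fallingℤ (+ (x ℕ.+ c)) n) * ℤtoℚ z) (shape (+ c) (+ n) (+ x)) ⟩
  ℤtoℚ (fallingℤ (+ (x ℕ.+ c)) n) * ℤtoℚ (+ (x ℕ.+ c) ℤ.- + n)
    ≡⟨ ℤtoℚ-homo-* (fallingℤ (+ (x ℕ.+ c)) n) (+ (x ℕ.+ c) ℤ.- + n) ⟨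
  ℤtoℚ (fallingℤ (+ (x ℕ.+ c)) (suc n)) ∎
  where
  open ≡-Reasoning
  e = ℤtoℚ (+ c ℤ.- + n)
  linear : ∀ e y → e + y * (1ℚ + y * 0ℚ) ≡ e + y
  linear = solve-∀ ℚ-ring
  shape : ∀ c n x → (c ℤ.- n) ℤ.+ x ≡ (x ℤ.+ c) ℤ.- n
  shape = ℤ-Solver.solve-∀

eval-binomPoly : ∀ c n x → eval (binomPoly c n) (ℕtoℚ x) ≡ ℕtoℚ ((x ℕ.+ c) C n)
eval-binomPoly c n x = begin
  eval (scaleₚ (invFact n) (fallingProd c n)) (ℕtoℚ x)
    ≡⟨ eval-scaleₚ (invFact n) (fallingProd c n) (ℕtoℚ x) ⟩
  invFact n * eval (fallingProd c n) (ℕtoℚ x)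
    ≡⟨ cong (invFact n *_) (eval-fallingProd c n x) ⟩
  invFact n * ℤtoℚ (fallingℤ (+ (x ℕ.+ c)) n)
    ≡⟨ cong (λ z → invFact n * ℤtoℚ z) (fallingℤ-C (x ℕ.+ c) n) ⟩
  invFact n * ℤtoℚ (+ (n !) ℤ.* + ((x ℕ.+ c) C n))
    ≡⟨ cong (invFact n *_) (ℤtoℚ-homo-* (+ (n !)) (+ ((x ℕ.+ c) C n))) ⟩
  invFact n * (ℕtoℚ (n !) * ℕtoℚ ((x ℕ.+ c) C n))
    ≡⟨ ℚₚ.*-assoc (invFact n) (ℕtoℚ (n !)) _ ⟨
  (invFact n * ℕtoℚ (n !)) * ℕtoℚ ((x ℕ.+ c) C n)
    ≡⟨ cong (_* ℕtoℚ ((x ℕ.+ c) C n))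
            (trans (ℚₚ.*-comm (invFact n) (ℕtoℚ (n !))) (ℕtoℚ-*-inverse (n !) {{n !≢0}})) ⟩
  1ℚ * ℕtoℚ ((x ℕ.+ c) C n)
    ≡⟨ ℚₚ.*-identityˡ _ ⟩
  ℕtoℚ ((x ℕ.+ c) C n) ∎
  where open ≡-Reasoning

dilate : ℕ → Poly → Poly
dilate a []      = []
dilate a (c ∷ p) = c ∷ scaleₚ (ℕtoℚ a) (dilate a p)

eval-dilate : ∀ a p y → eval (dilate a p) y ≡ eval p (ℕtoℚ a * y)
eval-dilate a []      y = refl
eval-dilate a (c ∷ p) y = begin
  c + y * eval (scaleₚ (ℕtoℚ a) (dilate a p)) y
    ≡⟨ cong (λ v → c + y * v) (eval-scaleₚ (ℕtoℚ a) (dilate a p) y) ⟩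
  c + y * (ℕtoℚ a * eval (dilate a p) y)
    ≡⟨ cong (λ v → c + y * (ℕtoℚ a * v)) (eval-dilate a p y) ⟩
  c + y * (ℕtoℚ a * eval p (ℕtoℚ a * y))
    ≡⟨ regroup c y (ℕtoℚ a) (eval p (ℕtoℚ a * y)) ⟩
  c + (ℕtoℚ a * y) * eval p (ℕtoℚ a * y) ∎
  where
  open ≡-Reasoning
  regroup : ∀ c y α u → c + y * (α * u) ≡ c + (α * y) * u
  regroup = solve-∀ ℚ-ring

coeff-dilate : ∀ a p j → coeff j (dilate a p) ≡ ℕtoℚ (a ^ j) * coeff j p
coeff-dilate a []      j       = sym (ℚₚ.*-zeroʳ (ℕtoℚ (a ^ j)))
coeff-dilate a (c ∷ p) zero    = sym (ℚₚ.*-identityˡ c)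
coeff-dilate a (c ∷ p) (suc j) = begin
  coeff j (scaleₚ (ℕtoℚ a) (dilate a p))        ≡⟨ coeff-scaleₚ (ℕtoℚ a) (dilate a p) j ⟩
  ℕtoℚ a * coeff j (dilate a p)                 ≡⟨ cong (ℕtoℚ a *_) (coeff-dilate a p j) ⟩
  ℕtoℚ a * (ℕtoℚ (a ^ j) * coeff j p)           ≡⟨ ℚₚ.*-assoc (ℕtoℚ a) (ℕtoℚ (a ^ j)) (coeff j p) ⟨
  ℕtoℚ a * ℕtoℚ (a ^ j) * coeff j p             ≡⟨ cong (_* coeff j p) (ℕtoℚ-homo-* a (a ^ j)) ⟨
  ℕtoℚ (a ^ suc j) * coeff j p                  ∎
  where open ≡-Reasoning

Deg<-dilate : ∀ {d} a p → Deg< d p → Deg< d (dilate a p)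
Deg<-dilate a p p<d {j} d≤j =
  trans (coeff-dilate a p j) (trans (cong (ℕtoℚ (a ^ j) *_) (p<d d≤j)) (ℚₚ.*-zeroʳ (ℕtoℚ (a ^ j))))

-- Lattice points in the dilates of P_m^(a,…,a)

T-injective : ∀ {b c} → (T b → T c) → (T c → T b) → b ≡ c
T-injective {false} {false} _   _   = refl
T-injective {false} {true}  _   c⇒b = ⊥-elim (c⇒b tt)
T-injective {true}  {false} b⇒c _   = ⊥-elim (b⇒c tt)
T-injective {true}  {true}  _   _   = refl

/-≤⇒*-≤ : ∀ x y d e → (+ x) / suc d ℚ.≤ (+ y) / suc e → x ℕ.* suc e ≤ y ℕ.* suc d
/-≤⇒*-≤ x y d e x/d≤y/e
  with ℚᵘₚ.≤-respʳ-≃ (toℚᵘ-/ (+ y) e) (ℚᵘₚ.≤-respˡ-≃ (toℚᵘ-/ (+ x) d) (ℚₚ.toℚᵘ-mono-≤ x/d≤y/e))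
... | ℚᵘ.*≤* xe≤yd = ℤₚ.drop‿+≤+ (subst₂ ℤ._≤_ (sym (ℤₚ.pos-* x (suc e))) (sym (ℤₚ.pos-* y (suc d))) xe≤yd)

*-≤⇒/-≤ : ∀ x y d e → x ℕ.* suc e ≤ y ℕ.* suc d → (+ x) / suc d ℚ.≤ (+ y) / suc e
*-≤⇒/-≤ x y d e xe≤yd = ℚₚ.toℚᵘ-cancel-≤ (ℚᵘₚ.≤-respʳ-≃ (ℚᵘₚ.≃-sym (toℚᵘ-/ (+ y) e))
  (ℚᵘₚ.≤-respˡ-≃ (ℚᵘₚ.≃-sym (toℚᵘ-/ (+ x) d))
    (ℚᵘ.*≤* (subst₂ ℤ._≤_ (ℤₚ.pos-* x (suc e)) (ℤₚ.pos-* y (suc d)) (ℤ.+≤+ xe≤yd)))))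

/-≤ᵇ-/ : ∀ x y d e → ((+ x) / suc d ℚ.≤ᵇ (+ y) / suc e) ≡ (x ℕ.* suc e ≤ᵇ y ℕ.* suc d)
/-≤ᵇ-/ x y d e = T-injective
  (ℕₚ.≤⇒≤ᵇ ∘ /-≤⇒*-≤ x y d e ∘ ℚₚ.≤ᵇ⇒≤)
  (ℚₚ.≤⇒≤ᵇ ∘ *-≤⇒/-≤ x y d e ∘ ℕₚ.≤ᵇ⇒≤ _ _)

*-cancelʳ-≤ᵇ : ∀ x y d → (x ℕ.* suc d ≤ᵇ y ℕ.* suc d) ≡ (x ≤ᵇ y)
*-cancelʳ-≤ᵇ x y d = T-injective
  (ℕₚ.≤⇒≤ᵇ ∘ ℕₚ.*-cancelʳ-≤ x y (suc d) ∘ ℕₚ.≤ᵇ⇒≤ _ _)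
  (ℕₚ.≤⇒≤ᵇ ∘ ℕₚ.*-monoˡ-≤ (suc d) ∘ ℕₚ.≤ᵇ⇒≤ x y)

isChain : ℕ → ℕ → List ℕ → Bool
isChain H lo []       = lo ≤ᵇ H
isChain H lo (x ∷ xs) = (lo ≤ᵇ x) ∧ isChain H x xs

fracs-replicate : ∀ m a xs → fracs xs (replicate m a) ≡ map (λ x → frac x a) (take m xs)
fracs-replicate zero    a []       = refl
fracs-replicate zero    a (x ∷ xs) = refl
fracs-replicate (suc m) a []       = refl
fracs-replicate (suc m) a (x ∷ xs) = cong (frac x a ∷_) (fracs-replicate m a xs)

chain-frac : ∀ t d lo xs →
  chain (frac lo (suc d)) (map (λ x → frac x (suc d)) xs) ((+ t) / 1) ≡ isChain (t ℕ.* suc d) lo xs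
chain-frac t d lo []       = trans (/-≤ᵇ-/ lo t d 0) (cong (_≤ᵇ t ℕ.* suc d) (ℕₚ.*-identityʳ lo))
chain-frac t d lo (x ∷ xs) = cong₂ _∧_ (trans (/-≤ᵇ-/ lo x d d) (*-cancelʳ-≤ᵇ lo x d)) (chain-frac t d x xs)

inDilate-replicate : ∀ t d m xs → inDilate t (replicate m (suc d)) xs ≡ isChain (t ℕ.* suc d) 0 (take m xs)
inDilate-replicate t d m xs = begin
  chain 0ℚ (fracs xs (replicate m (suc d))) ((+ t) / 1)
    ≡⟨ cong₂ (λ z zs → chain z zs ((+ t) / 1)) (sym (ℚₚ.0/n≡0 (suc d))) (fracs-replicate m (suc d) xs) ⟩
  chain (frac 0 (suc d)) (map (λ x → frac x (suc d)) (take m xs)) ((+ t) / 1)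
    ≡⟨ chain-frac t d 0 (take m xs) ⟩
  isChain (t ℕ.* suc d) 0 (take m xs)
    ∎
  where open ≡-Reasoning

length-filterᵇ-cong : ∀ {A : Set} (p q : A → Bool) xs → (∀ x → p x ≡ q x) →
                      length (filterᵇ p xs) ≡ length (filterᵇ q xs)
length-filterᵇ-cong p q []       p≗q = refl
length-filterᵇ-cong p q (x ∷ xs) p≗q with p x | q x | p≗q x
... | true  | .true  | refl = cong suc (length-filterᵇ-cong p q xs p≗q)
... | false | .false | refl = length-filterᵇ-cong p q xs p≗q

length-filterᵇ-concatMap : ∀ {A B : Set} (p : B → Bool) (f : A → List B) (g : ℕ → A) n →
  length (filterᵇ p (concatMap f (applyUpTo g n))) ≡ ℕ∑.∑< n (λ i → length (filterᵇ p (f (g i))))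
length-filterᵇ-concatMap p f g zero    = refl
length-filterᵇ-concatMap p f g (suc n) = begin
  length (filterᵇ p (f (g 0) ++ concatMap f (applyUpTo (g ∘ suc) n)))
    ≡⟨ cong length (filter-++ _ (f (g 0)) (concatMap f (applyUpTo (g ∘ suc) n))) ⟩
  length (filterᵇ p (f (g 0)) ++ filterᵇ p (concatMap f (applyUpTo (g ∘ suc) n)))
    ≡⟨ length-++ (filterᵇ p (f (g 0))) ⟩
  length (filterᵇ p (f (g 0))) ℕ.+ length (filterᵇ p (concatMap f (applyUpTo (g ∘ suc) n)))
    ≡⟨ cong (length (filterᵇ p (f (g 0))) ℕ.+_) (length-filterᵇ-concatMap p f (g ∘ suc) n) ⟩
  length (filterᵇ p (f (g 0))) ℕ.+ ℕ∑.∑< n (λ i → length (filterᵇ p (f (g (suc i)))))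
    ≡⟨ ℕ∑.∑<-suc n _ ⟨
  ℕ∑.∑< (suc n) (λ i → length (filterᵇ p (f (g i))))
    ∎
  where open ≡-Reasoning

length-filterᵇ-map-∷ : ∀ (p q : List ℕ → Bool) b x L → (∀ y → p (x ∷ y) ≡ b ∧ q y) →
  length (filterᵇ p (map (x ∷_) L)) ≡ (if b then length (filterᵇ q L) else 0)
length-filterᵇ-map-∷ p q false x []      p≗bq = refl
length-filterᵇ-map-∷ p q true  x []      p≗bq = refl
length-filterᵇ-map-∷ p q false x (y ∷ L) p≗bq with p (x ∷ y) | p≗bq y
... | .false | refl = length-filterᵇ-map-∷ p q false x L p≗bq
length-filterᵇ-map-∷ p q true  x (y ∷ L) p≗bq with p (x ∷ y) | q y | p≗bq y
... | .true  | true  | refl = cong suc (length-filterᵇ-map-∷ p q true x L p≗bq)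
... | .false | false | refl = length-filterᵇ-map-∷ p q true x L p≗bq

chains : ℕ → ℕ → ℕ → ℕ
chains H m lo = length (filterᵇ (isChain H lo ∘ take m) (box (replicate m H)))

chains-suc : ∀ H m lo → chains H (suc m) lo ≡ ℕ∑.∑< (suc H) (λ x → if lo ≤ᵇ x then chains H m x else 0)
chains-suc H m lo = trans
  (length-filterᵇ-concatMap (isChain H lo ∘ take (suc m)) (λ x → map (x ∷_) (box (replicate m H))) id (suc H))
  (ℕ∑.∑<-cong (suc H) (λ {x} _ →
    length-filterᵇ-map-∷ (isChain H lo ∘ take (suc m)) (isChain H x ∘ take m) (lo ≤ᵇ x) x
                         (box (replicate m H)) (λ _ → refl)))

suc-≤ᵇ-suc : ∀ m n → (suc m ≤ᵇ suc n) ≡ (m ≤ᵇ n)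
suc-≤ᵇ-suc zero    n = refl
suc-≤ᵇ-suc (suc m) n = refl

hockey-stick : ∀ H m lo → lo ≤ H →
  ℕ∑.∑< (suc H) (λ x → if lo ≤ᵇ x then (H ∸ x ℕ.+ m) C m else 0) ≡ (H ∸ lo ℕ.+ suc m) C suc m
hockey-stick zero    m zero     _          = trans (nCn≡1 m) (sym (nCn≡1 (suc m)))
hockey-stick (suc H) m zero     _          = begin
  ℕ∑.∑< (suc (suc H)) (λ x → (suc H ∸ x ℕ.+ m) C m)
    ≡⟨ ℕ∑.∑<-suc (suc H) _ ⟩
  (suc H ℕ.+ m) C m ℕ.+ ℕ∑.∑< (suc H) (λ x → (H ∸ x ℕ.+ m) C m)
    ≡⟨ cong₂ ℕ._+_ (cong (_C m) (sym (ℕₚ.+-suc H m)))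
                                                                          (hockey-stick H m 0 z≤n) ⟩
  (H ℕ.+ suc m) C m ℕ.+ (H ℕ.+ suc m) C suc m
    ≡⟨ nCk+nC[k+1]≡[n+1]C[k+1] (H ℕ.+ suc m) m ⟩
  (suc H ℕ.+ suc m) C suc m ∎
  where open ≡-Reasoning
hockey-stick (suc H) m (suc lo) (s≤s lo≤H) = begin
  ℕ∑.∑< (suc (suc H)) g
    ≡⟨ ℕ∑.∑<-suc (suc H) g ⟩
  ℕ∑.∑< (suc H) (g ∘ suc)
    ≡⟨ ℕ∑.∑<-cong (suc H) (λ {x} _ → cong (λ b → if b then (H ∸ x ℕ.+ m) C m else 0) (suc-≤ᵇ-suc lo x)) ⟩
  ℕ∑.∑< (suc H) (λ x → if lo ≤ᵇ x then (H ∸ x ℕ.+ m) C m else 0)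
    ≡⟨ hockey-stick H m lo lo≤H ⟩
  (H ∸ lo ℕ.+ suc m) C suc m ∎
  where
  open ≡-Reasoning
  g = λ x → if suc lo ≤ᵇ x then (suc H ∸ x ℕ.+ m) C m else 0

chains≡C : ∀ H m lo → lo ≤ H → chains H m lo ≡ (H ∸ lo ℕ.+ m) C m
chains≡C H zero    lo lo≤H rewrite T-injective {lo ≤ᵇ H} {true} (λ _ → tt) (λ _ → ℕₚ.≤⇒≤ᵇ lo≤H) = refl
chains≡C H (suc m) lo lo≤H = begin
  chains H (suc m) lo
    ≡⟨ chains-suc H m lo ⟩
  ℕ∑.∑< (suc H) (λ x → if lo ≤ᵇ x then chains H m x else 0)
    ≡⟨ ℕ∑.∑<-cong (suc H) (λ {x} x<1+H → cong (λ c → if lo ≤ᵇ x then c else 0)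
                                              (chains≡C H m x (ℕₚ.≤-pred x<1+H))) ⟩
  ℕ∑.∑< (suc H) (λ x → if lo ≤ᵇ x then (H ∸ x ℕ.+ m) C m else 0)
    ≡⟨ hockey-stick H m lo lo≤H ⟩
  (H ∸ lo ℕ.+ suc m) C suc m ∎
  where open ≡-Reasoning

ehrhart-constSeq : ∀ m d t → ehrhart (constSeq m (suc d)) t ≡ (t ℕ.* suc d ℕ.+ m) C m
ehrhart-constSeq m d t = begin
  length (filterᵇ (inDilate t (replicate m (suc d))) (box (map (t ℕ.*_) (replicate m (suc d)))))
    ≡⟨ cong (λ s → length (filterᵇ (inDilate t (replicate m (suc d))) (box s)))
            (map-replicate (t ℕ.*_) m (suc d)) ⟩
  length (filterᵇ (inDilate t (replicate m (suc d))) (box (replicate m (t ℕ.* suc d))))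
    ≡⟨ length-filterᵇ-cong _ _ (box (replicate m (t ℕ.* suc d))) (inDilate-replicate t d m) ⟩
  chains (t ℕ.* suc d) m 0
    ≡⟨ chains≡C (t ℕ.* suc d) m 0 z≤n ⟩
  (t ℕ.* suc d ℕ.+ m) C m
    ∎
  where open ≡-Reasoning

-- The h*-vector

∇ : (ℕ → ℤ) → ℕ → ℤ
∇ f zero    = f zero
∇ f (suc i) = f (suc i) ℤ.- f i

∇^ : ℕ → (ℕ → ℤ) → ℕ → ℤ
∇^ zero    f = f
∇^ (suc p) f = ∇ (∇^ p f)

∇-cong : ∀ {f g} → (∀ i → f i ≡ g i) → ∀ i → ∇ f i ≡ ∇ g i
∇-cong f≗g zero    = f≗g zero
∇-cong f≗g (suc i) = cong₂ ℤ._-_ (f≗g (suc i)) (f≗g i)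

∇^-suc : ∀ p f i → ∇^ (suc p) f i ≡ ∇^ p (∇ f) i
∇^-suc zero    f i = refl
∇^-suc (suc p) f i = ∇-cong (∇^-suc p f) i

alternating : ℕ → (ℕ → ℤ) → ℕ → ℕ → ℤ
alternating p f i zero    = sign 0 ℤ.* + (p C 0) ℤ.* f i
alternating p f i (suc k) = alternating p f i k ℤ.+ sign (suc k) ℤ.* + (p C suc k) ℤ.* f (i ∸ suc k)

alternating-zero : ∀ f i k → alternating 0 f i k ≡ f i
alternating-zero f i zero    = ℤₚ.*-identityˡ (f i)
alternating-zero f i (suc k) = begin
  alternating 0 f i k ℤ.+ sign (suc k) ℤ.* + 0 ℤ.* f (i ∸ suc k)
    ≡⟨ cong₂ ℤ._+_ (alternating-zero f i k) (vanish (sign (suc k)) (f (i ∸ suc k))) ⟩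
  f i ℤ.+ + 0
    ≡⟨ ℤₚ.+-identityʳ (f i) ⟩
  f i ∎
  where
  open ≡-Reasoning
  vanish : ∀ s x → s ℤ.* + 0 ℤ.* x ≡ + 0
  vanish = ℤ-Solver.solve-∀

alternating-suc : ∀ p f i k →
  alternating (suc p) f (suc i) (suc k) ≡ alternating p f (suc i) (suc k) ℤ.- alternating p f i k
alternating-suc p f i zero = begin
  + 1 ℤ.* + 1 ℤ.* f (suc i) ℤ.+ ℤ.- (+ 1) ℤ.* + (suc p C 1) ℤ.* f i
    ≡⟨ cong (λ c → + 1 ℤ.* + 1 ℤ.* f (suc i) ℤ.+ ℤ.- (+ 1) ℤ.* + c ℤ.* f i)
            (trans (nC1≡n (suc p)) (cong suc (sym (nC1≡n p)))) ⟩
  + 1 ℤ.* + 1 ℤ.* f (suc i) ℤ.+ ℤ.- (+ 1) ℤ.* (+ 1 ℤ.+ + (p C 1)) ℤ.* f i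
    ≡⟨ regroup (+ (p C 1)) (f (suc i)) (f i) ⟩
  (+ 1 ℤ.* + 1 ℤ.* f (suc i) ℤ.+ ℤ.- (+ 1) ℤ.* + (p C 1) ℤ.* f i) ℤ.- + 1 ℤ.* + 1 ℤ.* f i
    ∎
  where
  open ≡-Reasoning
  regroup : ∀ c x y → + 1 ℤ.* + 1 ℤ.* x ℤ.+ ℤ.- (+ 1) ℤ.* (+ 1 ℤ.+ c) ℤ.* y
                    ≡ (+ 1 ℤ.* + 1 ℤ.* x ℤ.+ ℤ.- (+ 1) ℤ.* c ℤ.* y) ℤ.- + 1 ℤ.* + 1 ℤ.* y
  regroup = ℤ-Solver.solve-∀
alternating-suc p f i (suc k) = begin
  alternating (suc p) f (suc i) (suc k) ℤ.+ ℤ.- s ℤ.* + (suc p C suc (suc k)) ℤ.* f (i ∸ suc k)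
    ≡⟨ cong₂ (λ u c → u ℤ.+ ℤ.- s ℤ.* + c ℤ.* f (i ∸ suc k)) (alternating-suc p f i k)
             (sym (nCk+nC[k+1]≡[n+1]C[k+1] p (suc k))) ⟩
  (X ℤ.- Y) ℤ.+ ℤ.- s ℤ.* (+ (p C suc k) ℤ.+ + (p C suc (suc k))) ℤ.* f (i ∸ suc k)
    ≡⟨ regroup s (+ (p C suc k)) (+ (p C suc (suc k))) (f (i ∸ suc k)) X Y ⟩
  (X ℤ.+ ℤ.- s ℤ.* + (p C suc (suc k)) ℤ.* f (i ∸ suc k)) ℤ.- (Y ℤ.+ s ℤ.* + (p C suc k) ℤ.* f (i ∸ suc k))
    ∎
  where
  open ≡-Reasoning
  s = sign (suc k)
  X = alternating p f (suc i) (suc k)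
  Y = alternating p f i k
  regroup : ∀ s a b z x y → (x ℤ.- y) ℤ.+ ℤ.- s ℤ.* (a ℤ.+ b) ℤ.* z
                          ≡ (x ℤ.+ ℤ.- s ℤ.* b ℤ.* z) ℤ.- (y ℤ.+ s ℤ.* a ℤ.* z)
  regroup = ℤ-Solver.solve-∀

alternating≡∇^ : ∀ p f i → alternating p f i i ≡ ∇^ p f i
alternating≡∇^ zero    f i       = alternating-zero f i i
alternating≡∇^ (suc p) f zero    = alternating≡∇^ p f zero
alternating≡∇^ (suc p) f (suc i) = trans (alternating-suc p f i i)
  (cong₂ ℤ._-_ (alternating≡∇^ p f (suc i)) (alternating≡∇^ p f i))

hstarAux≡alternating : ∀ s i k → hstarAux s i k ≡ alternating (suc (length s)) (λ t → + ehrhart s t) i k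
hstarAux≡alternating s i zero    = refl
hstarAux≡alternating s i (suc k) =
  cong (ℤ._+ sign (suc k) ℤ.* + (suc (length s) C suc k) ℤ.* + ehrhart s (i ∸ suc k))
       (hstarAux≡alternating s i k)

hstar-constSeq : ∀ m a i → hstar (constSeq m a) i ≡ ∇^ (suc m) (λ t → + ehrhart (constSeq m a) t) i
hstar-constSeq m a i = trans (hstarAux≡alternating (constSeq m a) i i)
  (trans (cong (λ l → alternating (suc l) (λ t → + ehrhart (constSeq m a) t) i i) (length-replicate m))
         (alternating≡∇^ (suc m) (λ t → + ehrhart (constSeq m a) t) i))

∑<-∇ : ∀ f K → ℤ∑.∑< (suc K) (∇ f) ≡ f K
∑<-∇ f zero    = ℤₚ.+-identityˡ (f 0)
∑<-∇ f (suc K) = trans (cong (ℤ._+ ∇ f (suc K)) (∑<-∇ f K)) (telescope (f K) (f (suc K)))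
  where
  telescope : ∀ x y → x ℤ.+ (y ℤ.- x) ≡ y
  telescope = ℤ-Solver.solve-∀

∇^-at-zero : ∀ p f → ∇^ p f 0 ≡ f 0
∇^-at-zero zero    f = refl
∇^-at-zero (suc p) f = ∇^-at-zero p f

-- The coefficient of z^K in (Σᵢ g(i) zⁱ) / (1 − z)^(p+1).
weighted : ℕ → (ℕ → ℤ) → ℕ → ℤ
weighted p g K = ℤ∑.∑< (suc K) (λ i → + ((K ∸ i ℕ.+ p) C p) ℤ.* g i)

weighted-cong : ∀ p {g h} → (∀ i → g i ≡ h i) → ∀ K → weighted p g K ≡ weighted p h K
weighted-cong p g≗h K = ℤ∑.∑<-cong (suc K) (λ {i} _ → cong (+ ((K ∸ i ℕ.+ p) C p) ℤ.*_) (g≗h i))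

weighted-suc : ∀ p g K → weighted (suc p) g (suc K) ≡ weighted (suc p) g K ℤ.+ weighted p g (suc K)
weighted-suc p g K = begin
  ℤ∑.∑< (suc K) w ℤ.+ w (suc K)
    ≡⟨ cong₂ ℤ._+_ (ℤ∑.∑<-cong (suc K) (pascal ∘ ℕₚ.≤-pred)) (last (suc p)) ⟩
  ℤ∑.∑< (suc K) (λ i → w₁ i ℤ.+ w₂ i) ℤ.+ g (suc K)
    ≡⟨ cong (ℤ._+ g (suc K)) (ℤ∑.∑<-+ (suc K) w₁ w₂) ⟩
  (ℤ∑.∑< (suc K) w₁ ℤ.+ ℤ∑.∑< (suc K) w₂) ℤ.+ g (suc K)
    ≡⟨ ℤₚ.+-assoc (ℤ∑.∑< (suc K) w₁) (ℤ∑.∑< (suc K) w₂) (g (suc K)) ⟩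
  ℤ∑.∑< (suc K) w₁ ℤ.+ (ℤ∑.∑< (suc K) w₂ ℤ.+ g (suc K))
    ≡⟨ cong (λ x → ℤ∑.∑< (suc K) w₁ ℤ.+ (ℤ∑.∑< (suc K) w₂ ℤ.+ x)) (last p) ⟨
  ℤ∑.∑< (suc K) w₁ ℤ.+ (ℤ∑.∑< (suc K) w₂ ℤ.+ w₂ (suc K)) ∎
  where
  open ≡-Reasoning
  w w₁ w₂ : ℕ → ℤ
  w  i = + ((suc K ∸ i ℕ.+ suc p) C suc p) ℤ.* g i
  w₁ i = + ((K ∸ i ℕ.+ suc p) C suc p) ℤ.* g i
  w₂ i = + ((suc K ∸ i ℕ.+ p) C p) ℤ.* g i
  last : ∀ q → + ((suc K ∸ suc K ℕ.+ q) C q) ℤ.* g (suc K) ≡ g (suc K)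
  last q = trans (cong (λ c → + (c C q) ℤ.* g (suc K)) (cong (ℕ._+ q) (ℕₚ.n∸n≡0 (suc K))))
                 (trans (cong (λ c → + c ℤ.* g (suc K)) (nCn≡1 q)) (ℤₚ.*-identityˡ (g (suc K))))
  pascal : ∀ {i} → i ≤ K → w i ≡ w₁ i ℤ.+ w₂ i
  pascal {i} i≤K = begin
    + ((suc K ∸ i ℕ.+ suc p) C suc p) ℤ.* g i
      ≡⟨ cong (λ c → + ((c ℕ.+ suc p) C suc p) ℤ.* g i) (ℕₚ.+-∸-assoc 1 i≤K) ⟩
    + (suc (K ∸ i ℕ.+ suc p) C suc p) ℤ.* g i
      ≡⟨ cong (λ c → + c ℤ.* g i) (nCk+nC[k+1]≡[n+1]C[k+1] (K ∸ i ℕ.+ suc p) p) ⟨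
    + ((K ∸ i ℕ.+ suc p) C p ℕ.+ (K ∸ i ℕ.+ suc p) C suc p) ℤ.* g i
      ≡⟨ ℤₚ.*-distribʳ-+ (g i) (+ ((K ∸ i ℕ.+ suc p) C p)) (+ ((K ∸ i ℕ.+ suc p) C suc p)) ⟩
    + ((K ∸ i ℕ.+ suc p) C p) ℤ.* g i ℤ.+ w₁ i
      ≡⟨ ℤₚ.+-comm (+ ((K ∸ i ℕ.+ suc p) C p) ℤ.* g i) (w₁ i) ⟩
    w₁ i ℤ.+ + ((K ∸ i ℕ.+ suc p) C p) ℤ.* g i
      ≡⟨ cong (λ c → w₁ i ℤ.+ + (c C p) ℤ.* g i)
              (trans (ℕₚ.+-suc (K ∸ i) p) (cong (ℕ._+ p) (sym (ℕₚ.+-∸-assoc 1 i≤K)))) ⟩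
    w₁ i ℤ.+ w₂ i
      ∎

weighted-∇^ : ∀ p f K → weighted p (∇^ (suc p) f) K ≡ f K
weighted-∇^ zero    f K       = trans (ℤ∑.∑<-cong (suc K) (λ {i} _ → ℤₚ.*-identityˡ (∇ f i))) (∑<-∇ f K)
weighted-∇^ (suc p) f zero    = begin
  + 0 ℤ.+ + ((0 ℕ.+ suc p) C suc p) ℤ.* ∇^ (suc (suc p)) f 0
    ≡⟨ ℤₚ.+-identityˡ _ ⟩
  + (suc p C suc p) ℤ.* ∇^ (suc (suc p)) f 0
    ≡⟨ cong (λ c → + c ℤ.* ∇^ (suc (suc p)) f 0) (nCn≡1 (suc p)) ⟩
  + 1 ℤ.* ∇^ (suc (suc p)) f 0
    ≡⟨ ℤₚ.*-identityˡ _ ⟩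
  ∇^ (suc (suc p)) f 0
    ≡⟨ ∇^-at-zero (suc (suc p)) f ⟩
  f 0 ∎
  where open ≡-Reasoning
weighted-∇^ (suc p) f (suc K) = begin
  weighted (suc p) (∇^ (suc (suc p)) f) (suc K)
    ≡⟨ weighted-suc p (∇^ (suc (suc p)) f) K ⟩
  weighted (suc p) (∇^ (suc (suc p)) f) K ℤ.+ weighted p (∇^ (suc (suc p)) f) (suc K)
    ≡⟨ cong₂ ℤ._+_ (weighted-∇^ (suc p) f K) (weighted-cong p (∇^-suc (suc p) f) (suc K)) ⟩
  f K ℤ.+ weighted p (∇^ (suc p) (∇ f)) (suc K)
    ≡⟨ cong (ℤ._+_ (f K)) (weighted-∇^ p (∇ f) (suc K)) ⟩
  f K ℤ.+ (f (suc K) ℤ.- f K)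
    ≡⟨ telescope (f K) (f (suc K)) ⟩
  f (suc K)
    ∎
  where
  open ≡-Reasoning
  telescope : ∀ x y → x ℤ.+ (y ℤ.- x) ≡ y
  telescope = ℤ-Solver.solve-∀

ehrhart-hstar : ∀ m a t → + ehrhart (constSeq m a) t ≡ weighted m (hstar (constSeq m a)) t
ehrhart-hstar m a t = sym (trans (weighted-cong m (hstar-constSeq m a) t)
                                 (weighted-∇^ m (λ t → + ehrhart (constSeq m a) t) t))

[1+m]∸i∸1≡m∸i : ∀ m i → suc m ∸ i ∸ 1 ≡ m ∸ i
[1+m]∸i∸1≡m∸i m i = trans (ℕₚ.∸-+-assoc (suc m) i 1) (cong (suc m ∸_) (ℕₚ.+-comm i 1))

RAux-Deg< : ∀ n a N → Deg< (suc n) (RAux n a N)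
RAux-Deg< n a zero    _   = refl
RAux-Deg< n a (suc N) =
  Deg<-+ₚ (RAux n a N) (scaleₚ h B) (RAux-Deg< n a N) (Deg<-scaleₚ h B (binomPoly-Deg< (n ∸ N ∸ 1) n))
  where
  h = ℤtoℚ (hstar (constSeq (n ∸ 1) a) N)
  B = binomPoly (n ∸ N ∸ 1) n

eval-RAux : ∀ n a N x → eval (RAux n a N) (ℕtoℚ x) ≡
  ℤtoℚ (ℤ∑.∑< N (λ i → hstar (constSeq (n ∸ 1) a) i ℤ.* + ((x ℕ.+ (n ∸ i ∸ 1)) C n)))
eval-RAux n a zero    x = refl
eval-RAux n a (suc N) x = begin
  eval (RAux n a N +ₚ scaleₚ (ℤtoℚ h) B) (ℕtoℚ x)
    ≡⟨ eval-+ₚ (RAux n a N) (scaleₚ (ℤtoℚ h) B) (ℕtoℚ x) ⟩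
  eval (RAux n a N) (ℕtoℚ x) + eval (scaleₚ (ℤtoℚ h) B) (ℕtoℚ x)
    ≡⟨ cong₂ _+_ (eval-RAux n a N x) (eval-scaleₚ (ℤtoℚ h) B (ℕtoℚ x)) ⟩
  ℤtoℚ (ℤ∑.∑< N term) + ℤtoℚ h * eval B (ℕtoℚ x)
    ≡⟨ cong (λ v → ℤtoℚ (ℤ∑.∑< N term) + ℤtoℚ h * v) (eval-binomPoly (n ∸ N ∸ 1) n x) ⟩
  ℤtoℚ (ℤ∑.∑< N term) + ℤtoℚ h * ℕtoℚ ((x ℕ.+ (n ∸ N ∸ 1)) C n)
    ≡⟨ cong (_+_ (ℤtoℚ (ℤ∑.∑< N term))) (ℤtoℚ-homo-* h (+ ((x ℕ.+ (n ∸ N ∸ 1)) C n))) ⟨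
  ℤtoℚ (ℤ∑.∑< N term) + ℤtoℚ (term N)
    ≡⟨ ℤtoℚ-homo-+ (ℤ∑.∑< N term) (term N) ⟨
  ℤtoℚ (ℤ∑.∑< (suc N) term)
    ∎
  where
  open ≡-Reasoning
  h = hstar (constSeq (n ∸ 1) a) N
  B = binomPoly (n ∸ N ∸ 1) n
  term : ℕ → ℤ
  term i = hstar (constSeq (n ∸ 1) a) i ℤ.* + ((x ℕ.+ (n ∸ i ∸ 1)) C n)

∑<≡weighted : ∀ m h x → x ≤ m →
  ℤ∑.∑< (suc m) (λ i → h i ℤ.* + ((x ℕ.+ (suc m ∸ i ∸ 1)) C m)) ≡ weighted m h x
∑<≡weighted m h x x≤m = begin
  ℤ∑.∑< (suc m) term                     ≡⟨ cong (λ k → ℤ∑.∑< k term) (ℕₚ.m+[n∸m]≡n (s≤s x≤m)) ⟨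
  ℤ∑.∑< (suc x ℕ.+ (suc m ∸ suc x)) term ≡⟨ ℤ∑.∑<-extend (suc x) (m ∸ x) term beyond ⟩
  ℤ∑.∑< (suc x) term                     ≡⟨ ℤ∑.∑<-cong (suc x) (λ {i} i<1+x → within (ℕₚ.≤-pred i<1+x)) ⟩
  weighted m h x                         ∎
  where
  open ≡-Reasoning
  term : ℕ → ℤ
  term i = h i ℤ.* + ((x ℕ.+ (suc m ∸ i ∸ 1)) C m)
  beyond : ∀ {i} → suc x ≤ i → i ℕ.< suc x ℕ.+ (m ∸ x) → term i ≡ + 0
  beyond {i} x<i i<1+m = begin
    h i ℤ.* + ((x ℕ.+ (suc m ∸ i ∸ 1)) C m)  ≡⟨ cong (λ k → h i ℤ.* + ((x ℕ.+ k) C m)) ([1+m]∸i∸1≡m∸i m i) ⟩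
    h i ℤ.* + ((x ℕ.+ (m ∸ i)) C m)          ≡⟨ cong (λ c → h i ℤ.* + c) (k>n⇒nCk≡0 small) ⟩
    h i ℤ.* + 0                              ≡⟨ ℤₚ.*-zeroʳ (h i) ⟩
    + 0                                      ∎
    where
    i≤m : i ≤ m
    i≤m = ℕₚ.≤-pred (subst (i ℕ.<_) (ℕₚ.m+[n∸m]≡n (s≤s x≤m)) i<1+m)
    small : x ℕ.+ (m ∸ i) ℕ.< m
    small = subst (x ℕ.+ (m ∸ i) ℕ.<_) (ℕₚ.m+[n∸m]≡n i≤m) (ℕₚ.+-monoˡ-< (m ∸ i) x<i)
  within : ∀ {i} → i ≤ x → term i ≡ + ((x ∸ i ℕ.+ m) C m) ℤ.* h i
  within {i} i≤x = trans (cong (λ k → h i ℤ.* + (k C m)) shift-index) (ℤₚ.*-comm (h i) _)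
    where
    shift-index : x ℕ.+ (suc m ∸ i ∸ 1) ≡ x ∸ i ℕ.+ m
    shift-index = begin
      x ℕ.+ (suc m ∸ i ∸ 1)            ≡⟨ cong (x ℕ.+_) ([1+m]∸i∸1≡m∸i m i) ⟩
      x ℕ.+ (m ∸ i)                    ≡⟨ cong (ℕ._+ (m ∸ i)) (ℕₚ.m∸n+n≡m i≤x) ⟨
      x ∸ i ℕ.+ i ℕ.+ (m ∸ i)          ≡⟨ ℕₚ.+-assoc (x ∸ i) i (m ∸ i) ⟩
      x ∸ i ℕ.+ (i ℕ.+ (m ∸ i))        ≡⟨ cong (x ∸ i ℕ.+_) (ℕₚ.m+[n∸m]≡n (ℕₚ.≤-trans i≤x x≤m)) ⟩
      x ∸ i ℕ.+ m                      ∎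

R-step : ∀ m a x → x ≤ m →
  eval (R (suc m) a) (ℕtoℚ (suc x)) ≡ eval (R (suc m) a) (ℕtoℚ x) + ℕtoℚ (ehrhart (constSeq m a) x)
R-step m a x x≤m = begin
  eval (R (suc m) a) (ℕtoℚ (suc x))
    ≡⟨ eval-RAux (suc m) a (suc m) (suc x) ⟩
  ℤtoℚ (ℤ∑.∑< (suc m) term₁)
    ≡⟨ cong ℤtoℚ (ℤ∑.∑<-cong (suc m) (λ {i} _ → pascal i)) ⟩
  ℤtoℚ (ℤ∑.∑< (suc m) (λ i → term₀ i ℤ.+ termₗ i))
    ≡⟨ cong ℤtoℚ (ℤ∑.∑<-+ (suc m) term₀ termₗ) ⟩
  ℤtoℚ (ℤ∑.∑< (suc m) term₀ ℤ.+ ℤ∑.∑< (suc m) termₗ)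
    ≡⟨ ℤtoℚ-homo-+ (ℤ∑.∑< (suc m) term₀) (ℤ∑.∑< (suc m) termₗ) ⟩
  ℤtoℚ (ℤ∑.∑< (suc m) term₀) + ℤtoℚ (ℤ∑.∑< (suc m) termₗ)
    ≡⟨ cong₂ _+_ (eval-RAux (suc m) a (suc m) x) (cong ℤtoℚ (sym (∑<≡weighted m h x x≤m))) ⟨
  eval (R (suc m) a) (ℕtoℚ x) + ℤtoℚ (weighted m h x)
    ≡⟨ cong (λ z → eval (R (suc m) a) (ℕtoℚ x) + ℤtoℚ z) (ehrhart-hstar m a x) ⟨
  eval (R (suc m) a) (ℕtoℚ x) + ℕtoℚ (ehrhart (constSeq m a) x) ∎
  where
  open ≡-Reasoning
  h : ℕ → ℤ
  h = hstar (constSeq m a)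
  term₁ term₀ termₗ : ℕ → ℤ
  term₁ i = h i ℤ.* + ((suc x ℕ.+ (suc m ∸ i ∸ 1)) C suc m)
  term₀ i = h i ℤ.* + ((x ℕ.+ (suc m ∸ i ∸ 1)) C suc m)
  termₗ i = h i ℤ.* + ((x ℕ.+ (suc m ∸ i ∸ 1)) C m)
  pascal : ∀ i → term₁ i ≡ term₀ i ℤ.+ termₗ i
  pascal i = begin
    h i ℤ.* + (suc N C suc m)                   ≡⟨ cong (λ c → h i ℤ.* + c) (nCk+nC[k+1]≡[n+1]C[k+1] N m) ⟨
    h i ℤ.* (+ (N C m) ℤ.+ + (N C suc m))       ≡⟨ ℤₚ.*-distribˡ-+ (h i) (+ (N C m)) (+ (N C suc m)) ⟩
    h i ℤ.* + (N C m) ℤ.+ h i ℤ.* + (N C suc m) ≡⟨ ℤₚ.+-comm (h i ℤ.* + (N C m)) (h i ℤ.* + (N C suc m)) ⟩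
    term₀ i ℤ.+ termₗ i                         ∎
    where N = x ℕ.+ (suc m ∸ i ∸ 1)

ehrhartPoly : ℕ → ℕ → Poly
ehrhartPoly m a = dilate a (binomPoly m m)

eval-ehrhartPoly : ∀ m d x → eval (ehrhartPoly m (suc d)) (ℕtoℚ x) ≡ ℕtoℚ (ehrhart (constSeq m (suc d)) x)
eval-ehrhartPoly m d x = begin
  eval (dilate (suc d) (binomPoly m m)) (ℕtoℚ x)
    ≡⟨ eval-dilate (suc d) (binomPoly m m) (ℕtoℚ x) ⟩
  eval (binomPoly m m) (ℕtoℚ (suc d) * ℕtoℚ x)
    ≡⟨ cong (eval (binomPoly m m)) (trans (ℚₚ.*-comm (ℕtoℚ (suc d)) (ℕtoℚ x)) (sym (ℕtoℚ-homo-* x (suc d)))) ⟩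
  eval (binomPoly m m) (ℕtoℚ (x ℕ.* suc d))
    ≡⟨ eval-binomPoly m m (x ℕ.* suc d) ⟩
  ℕtoℚ ((x ℕ.* suc d ℕ.+ m) C m)
    ≡⟨ cong ℕtoℚ (ehrhart-constSeq m d x) ⟨
  ℕtoℚ (ehrhart (constSeq m (suc d)) x) ∎
  where open ≡-Reasoning

Δ-R≡ehrhartPoly : ∀ m d j → coeff j (Δ (R (suc m) (suc d))) ≡ coeff j (ehrhartPoly m (suc d))
Δ-R≡ehrhartPoly m d = coeff≡-from-values (suc m) (Δ R′) L
  (Deg<-Δ R′ (RAux-Deg< (suc m) (suc d) (suc m))) (Deg<-dilate (suc d) (binomPoly m m) (binomPoly-Deg< m m)) agree
  where
  R′ = R (suc m) (suc d)
  L  = ehrhartPoly m (suc d)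
  agree : ∀ {x} → x ℕ.< suc m → eval (Δ R′) (ℕtoℚ x) ≡ eval L (ℕtoℚ x)
  agree {x} (s≤s x≤m) = begin
    eval (Δ R′) (ℕtoℚ x)                                          ≡⟨ eval-Δ R′ (ℕtoℚ x) ⟩
    eval R′ (1ℚ + ℕtoℚ x) - eval R′ (ℕtoℚ x)   ≡⟨ cong (λ u → eval R′ u - eval R′ (ℕtoℚ x)) (ℕtoℚ-homo-+ 1 x) ⟨
    eval R′ (ℕtoℚ (suc x)) - eval R′ (ℕtoℚ x)  ≡⟨ cong (_- eval R′ (ℕtoℚ x)) (R-step m (suc d) x x≤m) ⟩
    (eval R′ (ℕtoℚ x) + Lₓ) - eval R′ (ℕtoℚ x)  ≡⟨ cancel (eval R′ (ℕtoℚ x)) Lₓ ⟩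
    Lₓ                                         ≡⟨ eval-ehrhartPoly m d x ⟨
    eval L (ℕtoℚ x)                            ∎
    where
    open ≡-Reasoning
    Lₓ = ℕtoℚ (ehrhart (constSeq m (suc d)) x)
    cancel : ∀ r l → (r + l) - r ≡ l
    cancel = solve-∀ ℚ-ring

-- Asymptotics

-- A record rather than a Σ-type, so that M and f can be inferred from BigO M f.
record BigO (M : ℕ) (f : ℕ → ℚ) : Set where
  constructor bigO
  field
    constant : ℚ
    bounded  : ∀ d → ∣ f (suc d) ∣ ℚ.≤ constant * ℕtoℚ (suc d ^ M)

BigO-cong : ∀ {M f g} → (∀ d → f (suc d) ≡ g (suc d)) → BigO M f → BigO M g
BigO-cong f≗g (bigO B f≤) = bigO B λ d → subst (λ x → ∣ x ∣ ℚ.≤ B * _) (f≗g d) (f≤ d)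

BigO-zero : ∀ {M} → BigO M (λ _ → 0ℚ)
BigO-zero {M} = bigO 0ℚ λ d → ℚₚ.≤-reflexive (sym (ℚₚ.*-zeroˡ (ℕtoℚ (suc d ^ M))))

BigO-+ : ∀ {M f g} → BigO M f → BigO M g → BigO M (λ a → f a + g a)
BigO-+ {M} {f} {g} (bigO B₁ f≤) (bigO B₂ g≤) = bigO (B₁ + B₂) λ d → begin
  ∣ f (suc d) + g (suc d) ∣                          ≤⟨ ℚₚ.∣p+q∣≤∣p∣+∣q∣ (f (suc d)) (g (suc d)) ⟩
  ∣ f (suc d) ∣ + ∣ g (suc d) ∣                       ≤⟨ ℚₚ.+-mono-≤ (f≤ d) (g≤ d) ⟩
  B₁ * ℕtoℚ (suc d ^ M) + B₂ * ℕtoℚ (suc d ^ M)     ≡⟨ ℚₚ.*-distribʳ-+ (ℕtoℚ (suc d ^ M)) B₁ B₂ ⟨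
  (B₁ + B₂) * ℕtoℚ (suc d ^ M)                      ∎
  where open ℚₚ.≤-Reasoning

BigO-*ˡ : ∀ {M f} c → BigO M f → BigO M (λ a → c * f a)
BigO-*ˡ {M} {f} c (bigO B f≤) = bigO (∣ c ∣ * B) λ d → begin
  ∣ c * f (suc d) ∣                    ≡⟨ ℚₚ.∣p*q∣≡∣p∣*∣q∣ c (f (suc d)) ⟩
  ∣ c ∣ * ∣ f (suc d) ∣                 ≤⟨ ℚₚ.*-monoˡ-≤-nonNeg ∣ c ∣ {{ℚₚ.∣-∣-nonNeg c}} (f≤ d) ⟩
  ∣ c ∣ * (B * ℕtoℚ (suc d ^ M))       ≡⟨ ℚₚ.*-assoc ∣ c ∣ B _ ⟨
  ∣ c ∣ * B * ℕtoℚ (suc d ^ M)         ∎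
  where open ℚₚ.≤-Reasoning

BigO-- : ∀ {M f g} → BigO M f → BigO M g → BigO M (λ a → f a - g a)
BigO-- {f = f} {g} f-O g-O = BigO-cong (λ d → minus (f (suc d)) (g (suc d))) (BigO-+ f-O (BigO-*ˡ (- 1ℚ) g-O))
  where
  minus : ∀ x y → x + (- 1ℚ) * y ≡ x - y
  minus = solve-∀ ℚ-ring

BigO-∑< : ∀ {M} n (f : ℕ → ℕ → ℚ) → (∀ {i} → i ℕ.< n → BigO M (f i)) → BigO M (λ a → ∑< n (λ i → f i a))
BigO-∑< zero    f f-O = BigO-zero
BigO-∑< (suc n) f f-O = BigO-+ (BigO-∑< n f (λ i<n → f-O (ℕₚ.m<n⇒m<1+n i<n))) (f-O ℕₚ.≤-refl)

BigO-power : ∀ {M j} c → j ≤ M → BigO M (λ a → ℕtoℚ (a ^ j) * c)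
BigO-power {M} {j} c j≤M = bigO ∣ c ∣ λ d → begin
  ∣ ℕtoℚ (suc d ^ j) * c ∣
    ≡⟨ ℚₚ.∣p*q∣≡∣p∣*∣q∣ (ℕtoℚ (suc d ^ j)) c ⟩
  ∣ ℕtoℚ (suc d ^ j) ∣ * ∣ c ∣
    ≡⟨ cong (_* ∣ c ∣) (ℚₚ.0≤p⇒∣p∣≡p (ℕtoℚ-mono-≤ {0} {suc d ^ j} z≤n)) ⟩
  ℕtoℚ (suc d ^ j) * ∣ c ∣
    ≤⟨ ℚₚ.*-monoʳ-≤-nonNeg ∣ c ∣ {{ℚₚ.∣-∣-nonNeg c}} (ℕtoℚ-mono-≤ (ℕₚ.^-monoʳ-≤ (suc d) j≤M)) ⟩
  ℕtoℚ (suc d ^ M) * ∣ c ∣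
    ≡⟨ ℚₚ.*-comm (ℕtoℚ (suc d ^ M)) ∣ c ∣ ⟩
  ∣ c ∣ * ℕtoℚ (suc d ^ M) ∎
  where open ℚₚ.≤-Reasoning

BigO⇒negligible : ∀ {M f} → BigO M f → ∀ {c ε} → 0ℚ < c → 0ℚ < ε →
  ∃[ A ] ∀ a → 1 ≤ a → A ≤ a → ∣ f a ∣ < ε * (c * ℕtoℚ (a ^ suc M))
BigO⇒negligible {M} {f} (bigO B f≤) {c} {ε} 0<c 0<ε = N , negligible
  where
  δ = ε * c
  instance
    δ-positive : ℚ.Positive δ
    δ-positive = ℚₚ.pos*pos⇒pos ε {{ℚ.positive 0<ε}} c {{ℚ.positive 0<c}}
    δ-nonZero : ℚ.NonZero δ
    δ-nonZero = ℚₚ.pos⇒nonZero δ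
  N = proj₁ (archimedean (B * ℚ.1/ δ))
  B<δN : B < δ * ℕtoℚ N
  B<δN = begin-strict
    B                      ≡⟨ ℚₚ.*-identityʳ B ⟨
    B * 1ℚ                 ≡⟨ cong (B *_) (ℚₚ.*-inverseʳ δ) ⟨
    B * (δ * ℚ.1/ δ)       ≡⟨ regroup B δ (ℚ.1/ δ) ⟩
    δ * (B * ℚ.1/ δ)       <⟨ ℚₚ.*-monoʳ-<-pos δ (proj₂ (archimedean (B * ℚ.1/ δ))) ⟩
    δ * ℕtoℚ N             ∎
    where
    open ℚₚ.≤-Reasoning
    regroup : ∀ x y z → x * (y * z) ≡ y * (x * z)
    regroup = solve-∀ ℚ-ring
  negligible : ∀ a → 1 ≤ a → N ≤ a → ∣ f a ∣ < ε * (c * ℕtoℚ (a ^ suc M))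
  negligible (suc d) _ N≤a = begin-strict
    ∣ f (suc d) ∣                         ≤⟨ f≤ d ⟩
    B * aᴹ                                <⟨ ℚₚ.*-monoˡ-<-pos aᴹ {{ℚ.positive 0<aᴹ}} B<δN ⟩
    δ * ℕtoℚ N * aᴹ                       ≤⟨ ℚₚ.*-monoʳ-≤-nonNeg aᴹ {{ℚ.nonNegative (ℚₚ.<⇒≤ 0<aᴹ)}}
                                              (ℚₚ.*-monoˡ-≤-nonNeg δ {{ℚₚ.pos⇒nonNeg δ}} (ℕtoℚ-mono-≤ N≤a)) ⟩
    δ * ℕtoℚ (suc d) * aᴹ                 ≡⟨ regroup ε c (ℕtoℚ (suc d)) aᴹ ⟩
    ε * (c * (ℕtoℚ (suc d) * aᴹ))         ≡⟨ cong (λ x → ε * (c * x)) (ℕtoℚ-homo-* (suc d) (suc d ^ M)) ⟨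
    ε * (c * ℕtoℚ (suc d ^ suc M))        ∎
    where
    open ℚₚ.≤-Reasoning
    aᴹ = ℕtoℚ (suc d ^ M)
    0<aᴹ : 0ℚ < aᴹ
    0<aᴹ = ℕtoℚ-mono-< (ℕₚ.m^n>0 (suc d) M)
    regroup : ∀ e c a x → e * c * a * x ≡ e * (c * (a * x))
    regroup = solve-∀ ℚ-ring

BigO-cancelˡ : ∀ {M f} k → BigO M (λ a → ℕtoℚ (suc k) * f a) → BigO M f
BigO-cancelˡ {f = f} k kf-O = BigO-cong cancel (BigO-*ˡ ((+ 1) / suc k) kf-O)
  where
  cancel : ∀ d → (+ 1) / suc k * (ℕtoℚ (suc k) * f (suc d)) ≡ f (suc d)
  cancel d = begin
    (+ 1) / suc k * (ℕtoℚ (suc k) * f (suc d))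
      ≡⟨ ℚₚ.*-assoc ((+ 1) / suc k) (ℕtoℚ (suc k)) (f (suc d)) ⟨
    (+ 1) / suc k * ℕtoℚ (suc k) * f (suc d)
      ≡⟨ cong (_* f (suc d)) (trans (ℚₚ.*-comm ((+ 1) / suc k) (ℕtoℚ (suc k)))
                                                                               (ℕtoℚ-*-inverse (suc k))) ⟩
    1ℚ * f (suc d)
      ≡⟨ ℚₚ.*-identityˡ (f (suc d)) ⟩
    f (suc d) ∎
    where open ≡-Reasoning

-- Back-substitution from the top degree down: (j + 1) pⱼ₊₁ = (Δp)ⱼ − Σ_{i > j+1} C(i, j) pᵢ.
coeff-BigO-from-Δ : ∀ {M N j₀} (P : ℕ → Poly) → (∀ a → Deg< (suc N) (P a)) →
  (∀ {j} → j₀ ≤ j → BigO M (λ a → coeff j (Δ (P a)))) →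
  ∀ {i} → j₀ ℕ.< i → BigO M (λ a → coeff i (P a))
coeff-BigO-from-Δ {M} {N} {j₀} P P<1+N ΔP-O {i} j₀<i =
  descend N j₀<i (ℕₚ.+-monoˡ-≤ N (ℕₚ.≤-trans (s≤s z≤n) j₀<i))
  where
  vanishing : ∀ {i} → N ℕ.< i → BigO M (λ a → coeff i (P a))
  vanishing N<i = BigO-cong (λ d → sym (P<1+N (suc d) N<i)) BigO-zero
  descend : ∀ d {i} → j₀ ℕ.< i → N ℕ.< i ℕ.+ d → BigO M (λ a → coeff i (P a))
  descend zero    {i}     _    N<i+0    = vanishing (subst (N ℕ.<_) (ℕₚ.+-identityʳ i) N<i+0)
  descend (suc d) {suc j} j₀<i N<i+1+d with N ℕ.<? suc j
  ... | yes N<i = vanishing N<i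
  ... | no  N≮i =
    BigO-cancelˡ j (BigO-cong solved (BigO-- (ΔP-O (ℕₚ.≤-pred j₀<i)) (BigO-∑< (N ∸ suc j) term term-O)))
    where
    j<N : j ℕ.< N
    j<N = ℕₚ.≰⇒> (N≮i ∘ s≤s)
    term : ℕ → ℕ → ℚ
    term k a = ℕtoℚ ((suc (suc j) ℕ.+ k) C j) * coeff (suc (suc j) ℕ.+ k) (P a)
    term-O : ∀ {k} → k ℕ.< N ∸ suc j → BigO M (term k)
    term-O {k} _ = BigO-*ˡ (ℕtoℚ ((suc (suc j) ℕ.+ k) C j)) (descend d j₀<2+j+k N<2+j+k+d)
      where
      2+j≤2+j+k = ℕₚ.m≤m+n (suc (suc j)) k
      j₀<2+j+k = ℕₚ.<-≤-trans j₀<i (ℕₚ.≤-trans (ℕₚ.n≤1+n (suc j)) 2+j≤2+j+k)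
      N<2+j+k+d = ℕₚ.<-≤-trans N<i+1+d
                    (ℕₚ.≤-trans (ℕₚ.≤-reflexive (ℕₚ.+-suc (suc j) d)) (ℕₚ.+-monoˡ-≤ d 2+j≤2+j+k))
    solved : ∀ a → coeff j (Δ (P (suc a))) - ∑< (N ∸ suc j) (λ k → term k (suc a))
                 ≡ ℕtoℚ (suc j) * coeff (suc j) (P (suc a))
    solved a = trans (cong (_- tail) (coeff-Δ-expand (P (suc a)) j (P<1+N (suc a)) j<N))
                     (cancel (ℕtoℚ (suc j) * coeff (suc j) (P (suc a))) tail)
      where
      tail = ∑< (N ∸ suc j) (λ k → term k (suc a))
      cancel : ∀ x t → (x + t) - t ≡ x
      cancel = solve-∀ ℚ-ring

-- Faulhaber polynomials

nCk*[k!*[n∸k]!]≡n! : ∀ {n k} → k ≤ n → (n C k) ℕ.* (k ! ℕ.* (n ∸ k) !) ≡ n !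
nCk*[k!*[n∸k]!]≡n! {n} {k} k≤n = begin
  (n C k) ℕ.* (k ! ℕ.* (n ∸ k) !)
    ≡⟨ ℕₚ.*-comm (n C k) (k ! ℕ.* (n ∸ k) !) ⟩
  (k ! ℕ.* (n ∸ k) !) ℕ.* (n C k)
    ≡⟨ cong (k ! ℕ.* (n ∸ k) ! ℕ.*_) (nCk≡n!/k![n-k]! k≤n) ⟩
  (k ! ℕ.* (n ∸ k) !) ℕ.* (n ! ℕ./ (k ! ℕ.* (n ∸ k) !))
    ≡⟨ m*[n/m]≡n {{k !* (n ∸ k) !≢0}} (k![n∸k]!∣n! k≤n) ⟩
  n ! ∎
  where
  open ≡-Reasoning
  instance _ = k !* (n ∸ k) !≢0

C-invFact : ∀ {n k} → k ≤ n → ℕtoℚ (n C k) * invFact n ≡ invFact k * invFact (n ∸ k)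
C-invFact {n} {k} k≤n = *-inverse-unique {ℕtoℚ (k ! ℕ.* (n ∸ k) !)} (begin
  ℕtoℚ (k ! ℕ.* (n ∸ k) !) * (ℕtoℚ (n C k) * invFact n)
    ≡⟨ ℚₚ.*-assoc (ℕtoℚ (k ! ℕ.* (n ∸ k) !)) (ℕtoℚ (n C k)) (invFact n) ⟨
  ℕtoℚ (k ! ℕ.* (n ∸ k) !) * ℕtoℚ (n C k) * invFact n
    ≡⟨ cong (_* invFact n) (ℕtoℚ-homo-* (k ! ℕ.* (n ∸ k) !) (n C k)) ⟨
  ℕtoℚ (k ! ℕ.* (n ∸ k) ! ℕ.* (n C k)) * invFact n
    ≡⟨ cong (λ x → ℕtoℚ x * invFact n)
            (trans (ℕₚ.*-comm (k ! ℕ.* (n ∸ k) !) (n C k)) (nCk*[k!*[n∸k]!]≡n! k≤n)) ⟩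
  ℕtoℚ (n !) * invFact n
    ≡⟨ ℕtoℚ-*-inverse (n !) {{n !≢0}} ⟩
  1ℚ ∎)
  (trans (cong (_* (invFact k * invFact (n ∸ k))) (ℕtoℚ-homo-* (k !) ((n ∸ k) !)))
         (trans (regroup (ℕtoℚ (k !)) (ℕtoℚ ((n ∸ k) !)) (invFact k) (invFact (n ∸ k)))
                (cong₂ _*_ (ℕtoℚ-*-inverse (k !) {{k !≢0}}) (ℕtoℚ-*-inverse ((n ∸ k) !) {{(n ∸ k) !≢0}}))))
  where
  open ≡-Reasoning
  regroup : ∀ x y u v → x * y * (u * v) ≡ (x * u) * (y * v)
  regroup = solve-∀ ℚ-ring

appellCoeff : (ℕ → ℚ) → ℕ → ℕ → ℚ
appellCoeff β n i = β (n ∸ i) * (invFact i * invFact (n ∸ i))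

-- With β the Bernoulli numbers this is Faulhaber's polynomial, whose forward difference is t^(n−1)/(n − 1)!.
appell : (ℕ → ℚ) → ℕ → Poly
appell β n = applyUpTo (appellCoeff β n) (suc n)

appellCoeff-shifted : ∀ β j e {l} → l ≤ e →
  ℕtoℚ ((j ℕ.+ l) C j) * appellCoeff β (j ℕ.+ e) (j ℕ.+ l) ≡ invFact j * invFact e * (ℕtoℚ (e C l) * β (e ∸ l))
appellCoeff-shifted β j e {l} l≤e = begin
  ℕtoℚ ((j ℕ.+ l) C j) * (β (j ℕ.+ e ∸ (j ℕ.+ l)) * (invFact (j ℕ.+ l) * invFact (j ℕ.+ e ∸ (j ℕ.+ l))))
    ≡⟨ cong (λ k → ℕtoℚ ((j ℕ.+ l) C j) * (β k * (invFact (j ℕ.+ l) * invFact k))) (ℕₚ.[m+n]∸[m+o]≡n∸o j e l) ⟩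
  ℕtoℚ ((j ℕ.+ l) C j) * (β (e ∸ l) * (invFact (j ℕ.+ l) * invFact (e ∸ l)))
    ≡⟨ regroup (ℕtoℚ ((j ℕ.+ l) C j)) (β (e ∸ l)) (invFact (j ℕ.+ l)) (invFact (e ∸ l)) ⟩
  (ℕtoℚ ((j ℕ.+ l) C j) * invFact (j ℕ.+ l)) * (invFact (e ∸ l) * β (e ∸ l))
    ≡⟨ cong (λ x → x * (invFact (e ∸ l) * β (e ∸ l)))
            (trans (C-invFact (ℕₚ.m≤m+n j l)) (cong (λ k → invFact j * invFact k) (ℕₚ.m+n∸m≡n j l))) ⟩
  (invFact j * invFact l) * (invFact (e ∸ l) * β (e ∸ l))
    ≡⟨ regroup′ (invFact j) (invFact l) (invFact (e ∸ l)) (β (e ∸ l)) ⟩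
  invFact j * ((invFact l * invFact (e ∸ l)) * β (e ∸ l))
    ≡⟨ cong (λ x → invFact j * (x * β (e ∸ l))) (C-invFact l≤e) ⟨
  invFact j * ((ℕtoℚ (e C l) * invFact e) * β (e ∸ l))
    ≡⟨ regroup″ (invFact j) (ℕtoℚ (e C l)) (invFact e) (β (e ∸ l)) ⟩
  invFact j * invFact e * (ℕtoℚ (e C l) * β (e ∸ l))
    ∎
  where
  open ≡-Reasoning
  regroup : ∀ c b u v → c * (b * (u * v)) ≡ (c * u) * (v * b)
  regroup = solve-∀ ℚ-ring
  regroup′ : ∀ x u v b → (x * u) * (v * b) ≡ x * ((u * v) * b)
  regroup′ = solve-∀ ℚ-ring
  regroup″ : ∀ x c u b → x * ((c * u) * b) ≡ x * u * (c * b)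
  regroup″ = solve-∀ ℚ-ring

binomial-reverse : ∀ (β : ℕ → ℚ) e →
  ∑< (suc e) (λ l → ℕtoℚ (e C l) * β (e ∸ l)) ≡ ∑< (suc e) (λ l → ℕtoℚ (e C l) * β l)
binomial-reverse β e = trans
  (∑<-cong (suc e) (λ {l} l<1+e → cong (λ c → ℕtoℚ c * β (e ∸ l)) (nCk≡nC[n∸k] (ℕₚ.≤-pred l<1+e))))
  (∑<-reverse (suc e) (λ l → ℕtoℚ (e C l) * β l))

Δ-appell : ∀ β j e → coeff j (Δ (appell β (j ℕ.+ e))) ≡ invFact j * invFact e * ∑< e (λ l → ℕtoℚ (e C l) * β l)
Δ-appell β j e = begin
  coeff j (Δ A)
    ≡⟨ coeff-Δ A j ⟩
  coeff j (shift A) - coeff j A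
    ≡⟨ cong₂ _-_ shift-sum (coeff-applyUpTo a (suc (j ℕ.+ e)) j<) ⟩
  invFact j * invFact e * ∑< (suc e) (λ l → ℕtoℚ (e C l) * β l) - a j
    ≡⟨ cong₂ (λ s x → invFact j * invFact e * (∑< e (λ l → ℕtoℚ (e C l) * β l) + ℕtoℚ s * β e)
                       - β x * (invFact j * invFact x))
             (nCn≡1 e) (ℕₚ.m+n∸m≡n j e) ⟩
  invFact j * invFact e * (∑< e (λ l → ℕtoℚ (e C l) * β l) + 1ℚ * β e) - β e * (invFact j * invFact e)
    ≡⟨ cancel (invFact j) (invFact e) (∑< e (λ l → ℕtoℚ (e C l) * β l)) (β e) ⟩
  invFact j * invFact e * ∑< e (λ l → ℕtoℚ (e C l) * β l) ∎
  where
  open ≡-Reasoning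
  A = appell β (j ℕ.+ e)
  a = appellCoeff β (j ℕ.+ e)
  j< : j ℕ.< suc (j ℕ.+ e)
  j< = s≤s (ℕₚ.m≤m+n j e)
  shift-sum : coeff j (shift A) ≡ invFact j * invFact e * ∑< (suc e) (λ l → ℕtoℚ (e C l) * β l)
  shift-sum = begin
    coeff j (shift A)
      ≡⟨ coeff-shift A j (Deg<-applyUpTo a (suc (j ℕ.+ e))) ⟩
    ∑< (suc (j ℕ.+ e)) (λ i → ℕtoℚ (i C j) * coeff i A)
      ≡⟨ ∑<-cong (suc (j ℕ.+ e)) (λ {i} i< → cong (ℕtoℚ (i C j) *_) (coeff-applyUpTo a (suc (j ℕ.+ e)) i<)) ⟩
    ∑< (suc (j ℕ.+ e)) (λ i → ℕtoℚ (i C j) * a i)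
      ≡⟨ cong (λ k → ∑< k (λ i → ℕtoℚ (i C j) * a i)) (ℕₚ.+-suc j e) ⟨
    ∑< (j ℕ.+ suc e) (λ i → ℕtoℚ (i C j) * a i)
      ≡⟨ ∑<-split j (suc e) (λ i → ℕtoℚ (i C j) * a i) ⟩
    ∑< j (λ i → ℕtoℚ (i C j) * a i) + ∑< (suc e) (λ l → ℕtoℚ ((j ℕ.+ l) C j) * a (j ℕ.+ l))
      ≡⟨ cong₂ _+_ (∑<-zero j (λ {i} i<j → trans (cong (λ c → ℕtoℚ c * a i) (k>n⇒nCk≡0 i<j))
                                                  (ℚₚ.*-zeroˡ (a i))))
                   (∑<-cong (suc e) (λ {l} l<1+e → appellCoeff-shifted β j e (ℕₚ.≤-pred l<1+e))) ⟩
    0ℚ + ∑< (suc e) (λ l → invFact j * invFact e * (ℕtoℚ (e C l) * β (e ∸ l)))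
      ≡⟨ ℚₚ.+-identityˡ _ ⟩
    ∑< (suc e) (λ l → invFact j * invFact e * (ℕtoℚ (e C l) * β (e ∸ l)))
      ≡⟨ ∑<-*ˡ (suc e) (invFact j * invFact e) (λ l → ℕtoℚ (e C l) * β (e ∸ l)) ⟩
    invFact j * invFact e * ∑< (suc e) (λ l → ℕtoℚ (e C l) * β (e ∸ l))
      ≡⟨ cong (invFact j * invFact e *_) (binomial-reverse β e) ⟩
    invFact j * invFact e * ∑< (suc e) (λ l → ℕtoℚ (e C l) * β l)
      ∎
  cancel : ∀ u v s b → u * v * (s + 1ℚ * b) - b * (u * v) ≡ u * v * s
  cancel = solve-∀ ℚ-ring

-- B₀, …, B₄; the later Bernoulli numbers never enter the coefficient of t^(n∸4) and are set to 0.
bernoulli : ℕ → ℚ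
bernoulli l = coeff l (1ℚ ∷ - ((+ 1) / 2) ∷ (+ 1) / 6 ∷ 0ℚ ∷ - ((+ 1) / 30) ∷ [])

bernoulli-recurrence-1 : ∑< 1 (λ l → ℕtoℚ (1 C l) * bernoulli l) ≡ 1ℚ
bernoulli-recurrence-1 = refl

bernoulli-recurrence : ∀ e → 2 ≤ e → e ≤ 5 → ∑< e (λ l → ℕtoℚ (e C l) * bernoulli l) ≡ 0ℚ
bernoulli-recurrence 1 (s≤s ()) _
bernoulli-recurrence 2 _ _ = refl
bernoulli-recurrence 3 _ _ = refl
bernoulli-recurrence 4 _ _ = refl
bernoulli-recurrence 5 _ _ = refl
bernoulli-recurrence (suc (suc (suc (suc (suc (suc _)))))) _ (s≤s (s≤s (s≤s (s≤s (s≤s ())))))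

faulhaber : ℕ → Poly
faulhaber m = appell bernoulli (suc m)

faulhaber-Deg< : ∀ m → Deg< (suc (suc m)) (faulhaber m)
faulhaber-Deg< m = Deg<-applyUpTo (appellCoeff bernoulli (suc m)) (suc (suc m))

Δ-faulhaber : ∀ m j e → suc m ≡ j ℕ.+ e →
  coeff j (Δ (faulhaber m)) ≡ invFact j * invFact e * ∑< e (λ l → ℕtoℚ (e C l) * bernoulli l)
Δ-faulhaber m j e 1+m≡j+e =
  trans (cong (λ n → coeff j (Δ (appell bernoulli n))) 1+m≡j+e) (Δ-appell bernoulli j e)

Δ-faulhaber-top : ∀ m → coeff m (Δ (faulhaber m)) ≡ invFact m
Δ-faulhaber-top m = trans (Δ-faulhaber m m 1 (ℕₚ.+-comm 1 m))
  (trans (cong (invFact m * invFact 1 *_) bernoulli-recurrence-1) (unit (invFact m)))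
  where
  unit : ∀ x → x * invFact 1 * 1ℚ ≡ x
  unit = solve-∀ ℚ-ring

Δ-faulhaber-below : ∀ m j → m ∸ 4 ≤ j → j ℕ.< m → coeff j (Δ (faulhaber m)) ≡ 0ℚ
Δ-faulhaber-below m j m∸4≤j j<m = trans (Δ-faulhaber m j e (sym (ℕₚ.m+[n∸m]≡n (ℕₚ.m≤n⇒m≤1+n (ℕₚ.<⇒≤ j<m)))))
  (trans (cong (invFact j * invFact e *_) (bernoulli-recurrence e 2≤e e≤5))
         (ℚₚ.*-zeroʳ (invFact j * invFact e)))
  where
  e = suc m ∸ j
  2≤e : 2 ≤ e
  2≤e = ℕₚ.m+n≤o⇒m≤o∸n 2 (s≤s j<m)
  e≤5 : e ≤ 5
  e≤5 = ℕₚ.m≤n+o⇒m∸n≤o (suc m) j (subst (suc m ℕ.≤_) (ℕₚ.+-comm 5 j)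
          (s≤s (ℕₚ.≤-trans (ℕₚ.m≤n+m∸n m 4) (ℕₚ.+-monoʳ-≤ 4 m∸4≤j))))

Δ-faulhaber-above : ∀ m j → m ℕ.< j → coeff j (Δ (faulhaber m)) ≡ 0ℚ
Δ-faulhaber-above m j m<j = Deg<-Δ (faulhaber m) (faulhaber-Deg< m) m<j

-- The coefficient of t^(n ∸ 4) in R

faulhaberError : ℕ → ℕ → Poly
faulhaberError m a = R (suc m) a +ₚ scaleₚ (- ℕtoℚ (a ^ m)) (faulhaber m)

faulhaberError-Deg< : ∀ m a → Deg< (suc (suc m)) (faulhaberError m a)
faulhaberError-Deg< m a =
  Deg<-+ₚ (R (suc m) a) (scaleₚ c (faulhaber m)) (RAux-Deg< (suc m) a (suc m))
          (Deg<-scaleₚ c (faulhaber m) (faulhaber-Deg< m))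
  where c = - ℕtoℚ (a ^ m)

coeff-Δ-faulhaberError : ∀ m d j → coeff j (Δ (faulhaberError m (suc d)))
  ≡ ℕtoℚ (suc d ^ j) * coeff j (binomPoly m m) - ℕtoℚ (suc d ^ m) * coeff j (Δ (faulhaber m))
coeff-Δ-faulhaberError m d j = begin
  coeff j (Δ (faulhaberError m (suc d)))
    ≡⟨ coeff-Δ-+ₚ-scaleₚ R′ (faulhaber m) (- aᵐ) j (RAux-Deg< (suc m) (suc d) (suc m)) (faulhaber-Deg< m) ⟩
  coeff j (Δ R′) + (- aᵐ) * coeff j (Δ (faulhaber m))
    ≡⟨ cong (_+ (- aᵐ) * coeff j (Δ (faulhaber m))) (Δ-R≡ehrhartPoly m d j) ⟩
  coeff j (dilate (suc d) (binomPoly m m)) + (- aᵐ) * coeff j (Δ (faulhaber m))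
    ≡⟨ cong (_+ (- aᵐ) * coeff j (Δ (faulhaber m))) (coeff-dilate (suc d) (binomPoly m m) j) ⟩
  ℕtoℚ (suc d ^ j) * coeff j (binomPoly m m) + (- aᵐ) * coeff j (Δ (faulhaber m))
    ≡⟨ minus (ℕtoℚ (suc d ^ j) * coeff j (binomPoly m m)) aᵐ (coeff j (Δ (faulhaber m))) ⟩
  ℕtoℚ (suc d ^ j) * coeff j (binomPoly m m) - aᵐ * coeff j (Δ (faulhaber m))
    ∎
  where
  open ≡-Reasoning
  R′ = R (suc m) (suc d)
  aᵐ = ℕtoℚ (suc d ^ m)
  minus : ∀ x y z → x + (- y) * z ≡ x - y * z
  minus = solve-∀ ℚ-ring

Δ-faulhaberError-below : ∀ m j → m ∸ 4 ≤ j → j ℕ.< m → ∀ d →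
  coeff j (Δ (faulhaberError m (suc d))) ≡ ℕtoℚ (suc d ^ j) * coeff j (binomPoly m m)
Δ-faulhaberError-below m j m∸4≤j j<m d = begin
  coeff j (Δ (faulhaberError m (suc d)))                         ≡⟨ coeff-Δ-faulhaberError m d j ⟩
  x - ℕtoℚ (suc d ^ m) * coeff j (Δ (faulhaber m))               ≡⟨ cong (λ z → x - ℕtoℚ (suc d ^ m) * z)
                                                                         (Δ-faulhaber-below m j m∸4≤j j<m) ⟩
  x - ℕtoℚ (suc d ^ m) * 0ℚ                                      ≡⟨ drop x (ℕtoℚ (suc d ^ m)) ⟩
  x                                                              ∎
  where
  open ≡-Reasoning
  x = ℕtoℚ (suc d ^ j) * coeff j (binomPoly m m)
  drop : ∀ x y → x - y * 0ℚ ≡ x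
  drop = solve-∀ ℚ-ring

Δ-faulhaberError-top : ∀ m d → coeff m (Δ (faulhaberError m (suc d))) ≡ 0ℚ
Δ-faulhaberError-top m d = trans (coeff-Δ-faulhaberError m d m)
  (trans (cong₂ (λ u v → aᵐ * u - aᵐ * v) (binomPoly-leading m m) (Δ-faulhaber-top m)) (cancel aᵐ (invFact m)))
  where
  aᵐ = ℕtoℚ (suc d ^ m)
  cancel : ∀ x y → x * y - x * y ≡ 0ℚ
  cancel = solve-∀ ℚ-ring

Δ-faulhaberError-above : ∀ m j → m ℕ.< j → ∀ d → coeff j (Δ (faulhaberError m (suc d))) ≡ 0ℚ
Δ-faulhaberError-above m j m<j d = trans (coeff-Δ-faulhaberError m d j)
  (trans (cong₂ (λ u v → ℕtoℚ (suc d ^ j) * u - ℕtoℚ (suc d ^ m) * v)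
                (binomPoly-Deg< m m m<j) (Δ-faulhaber-above m j m<j))
         (vanish (ℕtoℚ (suc d ^ j)) (ℕtoℚ (suc d ^ m))))
  where
  vanish : ∀ x y → x * 0ℚ - y * 0ℚ ≡ 0ℚ
  vanish = solve-∀ ℚ-ring

Δ-faulhaberError-BigO : ∀ M {j} → suc M ∸ 4 ≤ j → BigO M (λ a → coeff j (Δ (faulhaberError (suc M) a)))
Δ-faulhaberError-BigO M {j} m∸4≤j = by-trichotomy (ℕₚ.<-cmp j (suc M))
  where
  E = faulhaberError (suc M)
  by-trichotomy : Tri (j ℕ.< suc M) (j ≡ suc M) (suc M ℕ.< j) → BigO M (λ a → coeff j (Δ (E a)))
  by-trichotomy (tri< j<m _ _) = BigO-cong (λ d → sym (Δ-faulhaberError-below (suc M) j m∸4≤j j<m d))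
                                           (BigO-power (coeff j (binomPoly (suc M) (suc M))) (ℕₚ.≤-pred j<m))
  by-trichotomy (tri≈ _ j≡m _) = BigO-cong (λ d → sym (trans (cong (λ i → coeff i (Δ (E (suc d)))) j≡m)
                                                             (Δ-faulhaberError-top (suc M) d)))
                                           BigO-zero
  by-trichotomy (tri> _ _ m<j) = BigO-cong (λ d → sym (Δ-faulhaberError-above (suc M) j m<j d)) BigO-zero

module _ (k : ℕ) where

  instance
    _ = suc k !≢0
    _ = ℕₚ.m*n≢0 720 (suc k !)

  mainConstant : ℚ
  mainConstant = (+ 1) / (720 ℕ.* suc k !)

  0<mainConstant : 0ℚ < mainConstant
  0<mainConstant = ℚₚ.positive⁻¹ mainConstant {{ℚₚ.normalize-pos 1 (720 ℕ.* suc k !)}}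

  ∣mainTerm∣ : ∀ a → ∣ mainTerm (5 ℕ.+ k) a ∣ ≡ mainConstant * ℕtoℚ (a ^ (4 ℕ.+ k))
  ∣mainTerm∣ a = begin
    ∣ - q ∣                          ≡⟨ ℚₚ.∣-p∣≡∣p∣ q ⟩
    ∣ q ∣                            ≡⟨ ℚₚ.0≤p⇒∣p∣≡p 0≤q ⟩
    q                                ≡⟨ /-as-* (+ (a ^ (4 ℕ.+ k))) (720 ℕ.* suc k !) ⟩
    ℕtoℚ (a ^ (4 ℕ.+ k)) * mainConstant  ≡⟨ ℚₚ.*-comm (ℕtoℚ (a ^ (4 ℕ.+ k))) mainConstant ⟩
    mainConstant * ℕtoℚ (a ^ (4 ℕ.+ k))  ∎
    where
    open ≡-Reasoning
    q = (+ (a ^ (4 ℕ.+ k))) / (720 ℕ.* suc k !)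
    0≤q = ℚₚ.nonNegative⁻¹ q {{ℚₚ.normalize-nonNeg (a ^ (4 ℕ.+ k)) (720 ℕ.* suc k !)}}

  faulhaber-B₄-coeff : coeff (suc k) (faulhaber (4 ℕ.+ k)) ≡ bernoulli 4 * (invFact (suc k) * invFact 4)
  faulhaber-B₄-coeff =
    trans (coeff-applyUpTo (appellCoeff bernoulli (5 ℕ.+ k)) (6 ℕ.+ k) (s≤s (s≤s (ℕₚ.m≤n+m k 4))))
    (cong (λ i → bernoulli i * (invFact (suc k) * invFact i)) (ℕₚ.m+n∸n≡m 4 k))

  mainTerm-faulhaber : ∀ a → mainTerm (5 ℕ.+ k) a ≡ ℕtoℚ (a ^ (4 ℕ.+ k)) * coeff (suc k) (faulhaber (4 ℕ.+ k))
  mainTerm-faulhaber a = begin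
    mainTerm (5 ℕ.+ k) a                                     ≡⟨ cong -_ (/-as-* (+ aᵐ) (720 ℕ.* suc k !)) ⟩
    - (ℕtoℚ aᵐ * mainConstant)                               ≡⟨ cong (λ x → - (ℕtoℚ aᵐ * x)) (invℕ-* 720 (suc k !)) ⟩
    - (ℕtoℚ aᵐ * ((+ 1) / 720 * invFact (suc k)))            ≡⟨ constants (ℕtoℚ aᵐ) (invFact (suc k)) ⟩
    ℕtoℚ aᵐ * (bernoulli 4 * (invFact (suc k) * invFact 4))  ≡⟨ cong (ℕtoℚ aᵐ *_) faulhaber-B₄-coeff ⟨
    ℕtoℚ aᵐ * coeff (suc k) (faulhaber (4 ℕ.+ k))            ∎
    where
    open ≡-Reasoning
    aᵐ = a ^ (4 ℕ.+ k)
    constants : ∀ x y → - (x * ((+ 1) / 720 * y)) ≡ x * (bernoulli 4 * (y * invFact 4))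
    constants = solve-∀ ℚ-ring

  coeff-R-mainTerm-BigO : BigO (3 ℕ.+ k) (λ a → coeff (suc k) (R (5 ℕ.+ k) a) - mainTerm (5 ℕ.+ k) a)
  coeff-R-mainTerm-BigO = BigO-cong same
    (coeff-BigO-from-Δ {j₀ = k} (faulhaberError (4 ℕ.+ k)) (faulhaberError-Deg< (4 ℕ.+ k))
                       (Δ-faulhaberError-BigO (3 ℕ.+ k)) (ℕₚ.n<1+n k))
    where
    same : ∀ d → coeff (suc k) (faulhaberError (4 ℕ.+ k) (suc d))
               ≡ coeff (suc k) (R (5 ℕ.+ k) (suc d)) - mainTerm (5 ℕ.+ k) (suc d)
    same d = begin
      coeff (suc k) (R′ +ₚ scaleₚ (- aᵐ) Φ)  ≡⟨ coeff-+ₚ R′ (scaleₚ (- aᵐ) Φ) (suc k) ⟩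
      r + coeff (suc k) (scaleₚ (- aᵐ) Φ)    ≡⟨ cong (_+_ r) (coeff-scaleₚ (- aᵐ) Φ (suc k)) ⟩
      r + (- aᵐ) * coeff (suc k) Φ           ≡⟨ minus r aᵐ (coeff (suc k) Φ) ⟩
      r - aᵐ * coeff (suc k) Φ               ≡⟨ cong (_-_ r) (mainTerm-faulhaber (suc d)) ⟨
      r - mainTerm (5 ℕ.+ k) (suc d)         ∎
      where
      open ≡-Reasoning
      aᵐ = ℕtoℚ (suc d ^ (4 ℕ.+ k))
      Φ  = faulhaber (4 ℕ.+ k)
      R′ = R (5 ℕ.+ k) (suc d)
      r  = coeff (suc k) R′
      minus : ∀ r x y → r + (- x) * y ≡ r - x * y
      minus = solve-∀ ℚ-ring

theorem3p9 : (n : ℕ) → 5 ≤ n → (ε : ℚ) → 0ℚ < ε →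
    ∃[ A ] ((a : ℕ) → 1 ≤ a → A ≤ a →
      ∣ coeff (n ∸ 4) (R n a) - mainTerm n a ∣ < ε * ∣ mainTerm n a ∣)
theorem3p9 _ (s≤s (s≤s (s≤s (s≤s (s≤s (z≤n {k})))))) ε 0<ε =
  A , λ a 1≤a A≤a → ℚₚ.<-respʳ-≡ (cong (ε *_) (sym (∣mainTerm∣ k a))) (negligible a 1≤a A≤a)
  where
  A-negligible = BigO⇒negligible (coeff-R-mainTerm-BigO k) (0<mainConstant k) 0<ε
  A = proj₁ A-negligible
  negligible = proj₂ A-negligible
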